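{- Let $n\ge1$, and for integers $k,l\ge0$ let $\mathfrak{DT}_n^{(k,l)}=\{T\in\mathfrak{DT}_n:\mathsf{top}(T)=k,\ \mathsf{iom}(T)=l\}$. If $k\ge1$, then there exists a bijection $\psi:\mathfrak{DT}_n^{(k,l)}\to\mathfrak{DT}_n^{(k-1,l+1)}$. Consequently, the pair $(\mathsf{comp},\mathsf{idr})$ is symmetric over $\mathfrak{S}_n(2413,3142)$, i.e. for all $a,b$, $|\{\pi\in\mathfrak{S}_n(2413,3142):\mathsf{comp}(\pi)=a,\mathsf{idr}(\pi)=b\}|=|\{\pi\in\mathfrak{S}_n(2413,3142):\mathsf{comp}(\pi)=b,\mathsf{idr}(\pi)=a\}|$.
   Context: A di-sk tree is a rooted binary tree (each node has at most one left child and at most one right child) whose nodes are labeled $\oplus$ or $\ominus$, such that no node has the same label as its right child. $\mathfrak{DT}_n$ is the set of di-sk trees with $n-1$ nodes. $\mathsf{top}(T)$ is the number of initial $\oplus$-nodes of $T$ in preorder (root, left subtree, right subtree, recursively), i.e. the number of nodes visited before the first $\ominus$-node (all nodes if there is none); equivalently, the number of consecutive $\oplus$-nodes at the top of the leftmost path from the root. $\mathsf{iom}(T)$ is the number of initial $\ominus$-nodes of $T$ in inorder (left subtree, root, right subtree, recursively), i.e. the number of nodes visited before the first $\oplus$-node (all nodes if there is none). $\mathfrak{S}_n(2413,3142)$ is the set of permutations of $[n]$ avoiding the patterns $2413$ and $3142$ (no subsequence order-isomorphic to either). For $\pi\in\mathfrak{S}_n$: $\mathsf{comp}(\pi)=|\{i\in[n]:\pi_j\le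 i\ \forall j\le i\}|$ (number of components), and $\mathsf{idr}(\pi)$ is the length of the initial descending run of $\pi$, i.e. the largest $m$ with $\pi_1>\pi_2>\cdots>\pi_m$. -}

module Defs where

open import Data.Bool using (Bool; true; false; _∧_; not; if_then_else_)
open import Data.Nat using (ℕ; zero; suc; _+_; _<ᵇ_; _≤ᵇ_; _≡ᵇ_)
open import Data.List using (List; []; _∷_; _++_; length; map; upTo; foldr)
open import Data.Product using (Σ; _×_)
open import Relation.Binary.PropositionalEquality using (_≡_)

data Label : Set where
  ⊕ ⊖ : Label

_==ᴸ_ : Label → Label → Bool
⊕ ==ᴸ ⊕ = true
⊖ ==ᴸ ⊖ = true
_ ==ᴸ _ = false

data BTree : Set where
  leaf : BTree
  node : Label → BTree → BTree → BTree

size : BTree → ℕ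
size leaf = 0
size (node _ l r) = suc (size l + size r)

rightOK : Label → BTree → Bool
rightOK s leaf = true
rightOK s (node s' _ _) = not (s ==ᴸ s')

isDiSk : BTree → Bool
isDiSk leaf = true
isDiSk (node s l r) = rightOK s r ∧ (isDiSk l ∧ isDiSk r)

preorder : BTree → List Label
preorder leaf = []
preorder (node s l r) = s ∷ (preorder l ++ preorder r)

inorder : BTree → List Label
inorder leaf = []
inorder (node s l r) = inorder l ++ (s ∷ inorder r)

initialRun : Label → List Label → ℕ
initialRun s [] = 0
initialRun s (x ∷ xs) = if s ==ᴸ x then suc (initialRun s xs) else 0

top : BTree → ℕ
top T = initialRun ⊕ (preorder T)

iom : BTree → ℕ
iom T = initialRun ⊖ (inorder T)

-- DT n k l = { T ∈ 𝔇𝔗_n : top T = k, iom T = l }, where 𝔇𝔗_n = di-sk trees with n-1 nodes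
DT : ℕ → ℕ → ℕ → Set
DT n k l = Σ BTree (λ T → (isDiSk T ≡ true) × ((suc (size T) ≡ n) × ((top T ≡ k) × (iom T ≡ l))))

-- Permutations, written in one-line notation as lists π₁ π₂ … πₙ of ℕ

-- upTo n = 0 ∷ … ∷ n-1, so this is [1..n]
oneTo : ℕ → List ℕ
oneTo n = map suc (upTo n)

elem : ℕ → List ℕ → Bool
elem x [] = false
elem x (y ∷ ys) = if x ≡ᵇ y then true else elem x ys

allB : {A : Set} → (A → Bool) → List A → Bool
allB p [] = true
allB p (x ∷ xs) = p x ∧ allB p xs

anyB : {A : Set} → (A → Bool) → List A → Bool
anyB p [] = false
anyB p (x ∷ xs) = if p x then true else anyB p xs

distinct : List ℕ → Bool
distinct [] = true
distinct (x ∷ xs) = not (elem x xs) ∧ distinct xs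

isPerm : ℕ → List ℕ → Bool
isPerm n π = (length π ≡ᵇ n) ∧ (distinct π ∧ allB (λ x → elem x (oneTo n)) π)

subseqs : ℕ → List ℕ → List (List ℕ)
subseqs zero xs = [] ∷ []
subseqs (suc k) [] = []
subseqs (suc k) (x ∷ xs) = map (x ∷_) (subseqs k xs) ++ subseqs (suc k) xs

orderIso : List ℕ → List ℕ → Bool
orderIso [] [] = true
orderIso (a ∷ as) (p ∷ ps) = pairs a as p ps ∧ orderIso as ps
  where
  pairs : ℕ → List ℕ → ℕ → List ℕ → Bool
  pairs a [] p [] = true
  pairs a (b ∷ bs) p (q ∷ qs) = ((a <ᵇ b) ≡ᵇᴮ (p <ᵇ q)) ∧ pairs a bs p qs
    where
    _≡ᵇᴮ_ : Bool → Bool → Bool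
    true ≡ᵇᴮ y = y
    false ≡ᵇᴮ y = not y
  pairs _ _ _ _ = false
orderIso _ _ = false

containsB : List ℕ → List ℕ → Bool
containsB π σ = anyB (λ s → orderIso s σ) (subseqs (length σ) π)

avoids2413-3142 : List ℕ → Bool
avoids2413-3142 π = not (containsB π (2 ∷ 4 ∷ 1 ∷ 3 ∷ [])) ∧ not (containsB π (3 ∷ 1 ∷ 4 ∷ 2 ∷ []))

max : ℕ → ℕ → ℕ
max a b = if a ≤ᵇ b then b else a

-- comp π = |{ i ∈ [n] : πⱼ ≤ i for all j ≤ i }|
-- helper: position i (1-based) of the current element, running maximum m of π₁..π_{i-1}
compAux : ℕ → ℕ → List ℕ → ℕ
compAux i m [] = 0
compAux i m (x ∷ xs) =
  let m' = max m x in
  (if m' ≤ᵇ i then suc (compAux (suc i) m' xs) else compAux (suc i) m' xs)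

comp : List ℕ → ℕ
comp π = compAux 1 0 π

idrAux : ℕ → List ℕ → ℕ
idrAux prev [] = 0
idrAux prev (x ∷ xs) = if x <ᵇ prev then suc (idrAux x xs) else 0

idr : List ℕ → ℕ
idr [] = 0
idr (x ∷ xs) = suc (idrAux x xs)

SepPerm : ℕ → ℕ → ℕ → Set
SepPerm n a b = Σ (List ℕ) (λ π → (isPerm n π ≡ true) × ((avoids2413-3142 π ≡ true) × ((comp π ≡ a) × (idr π ≡ b))))

-- The map ψ descends the leftmost path through the initial run of ⊕-nodes to its last node
-- node ⊕ L R, where L is a leaf or ⊖-rooted, and deletes that node. If R is a leaf, L takes its
-- place with a new childless ⊖-node hung below its leftmost node. If R = node ⊖ R₁ R₂, then L is
-- exchanged with the base V of the left ⊕-spine of R₁ (swapBase), turning R₁ into W, and V takes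
-- the place of the deleted node, with a new ⊖-node hung below its leftmost node whose right
-- subtree is node ⊕ W (flipLabels R₂). Either way the initial ⊕-run in preorder loses a node, the
-- initial ⊖-run in inorder gains one, and unhang recovers the pieces. Iterating ψ gives
-- DT n k l ≅ DT n l k.
--
-- A di-sk tree T encodes the separable permutation treePerm T, reading ⊕ as direct and ⊖ as skew
-- sum. The condition on right children makes the encoding injective, and every permutation
-- avoiding 2413 and 3142 of length at least 2 is a direct or skew sum, so treePerm is onto. The
-- descent word of treePerm T is the inorder word of T, and its components are the summands along
-- the initial ⊕-run, so comp = top + 1 and idr = iom + 1: the symmetry of (top, iom) transfers to
-- (comp, idr).

module Submission where

open import Defs
open import Axiom.UniquenessOfIdentityProofs.WithK using (uip)
open import Data.Bool using (Bool; true; false; _∧_; not; if_then_else_)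
open import Data.Bool.Properties using (T-≡)
open import Data.Empty using (⊥; ⊥-elim)
open import Data.List using (List; []; _∷_; _++_; length; map; foldl)
open import Data.List.Properties
  using (++-assoc; ++-identityʳ; length-++; length-map; map-++; foldl-++; ∷-injective; map-injective)
open import Data.List.Membership.Propositional using (_∈_; find)
open import Data.List.Membership.Propositional.Properties
  using (∈-map⁺; ∈-map⁻; ∈-upTo⁺; ∈-upTo⁻; ∈-++⁺ˡ; ∈-++⁺ʳ; ∈-++⁻)
open import Data.List.Relation.Binary.Sublist.Propositional using (_⊆_; []; _∷_; _∷ʳ_; ⊆-refl; ⊆-trans)
open import Data.List.Relation.Binary.Sublist.Propositional.Properties
  using (All-resp-⊆; Any-resp-⊆; []⊆-universal; ++⁺ˡ; ++⁺ʳ)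
import Data.List.Relation.Binary.Sublist.Propositional.Properties as Sublist
open import Data.List.Relation.Unary.All as All using (All; []; _∷_; all?)
import Data.List.Relation.Unary.All.Properties as All
open import Data.List.Relation.Unary.AllPairs using ([]; _∷_)
open import Data.List.Relation.Unary.Any using (here; there)
open import Data.List.Relation.Unary.Unique.Propositional using (Unique)
import Data.List.Relation.Unary.Unique.Propositional.Properties as Unique
open import Data.Nat
  using (ℕ; zero; suc; _+_; _∸_; _≤_; _<_; _⊔_; z≤n; s≤s; _<ᵇ_; _≤ᵇ_; _≡ᵇ_; _≟_; _<?_)
open import Data.Nat.Induction using (<-rec)
open import Data.Nat.Properties
open import Data.List.Membership.DecPropositional _≟_ using (_∈?_)
open import Data.Product as Prod using (Σ; Σ-syntax; ∃-syntax; _×_; _,_; proj₁; proj₂)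
open import Data.Sum using (_⊎_; inj₁; inj₂; swap)
open import Data.Unit using (⊤; tt)
open import Function using (_∘_)
open import Function.Bundles using (_↔_; _⤖_; mk↔ₛ′; Equivalence)
open import Function.Properties.Inverse using (↔-refl; ↔-sym; ↔-trans; ↔⇒⤖)
open import Relation.Binary.Definitions using (tri<; tri≈; tri>)
open import Relation.Binary.PropositionalEquality
  using (_≡_; _≢_; refl; sym; trans; cong; cong₂; subst; subst₂; module ≡-Reasoning)
open import Relation.Nullary using (¬_; yes; no)

∧-true⁻ : ∀ {a b} → a ∧ b ≡ true → a ≡ true × b ≡ true
∧-true⁻ {true} p = refl , p

∧-true⁺ : ∀ {a b} → a ≡ true → b ≡ true → a ∧ b ≡ true
∧-true⁺ refl refl = refl

false≢true : false ≡ true → ⊥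
false≢true ()

Σ-≡-proj₁ : ∀ {X : Set} {P : X → Set} → (∀ {x} (p q : P x) → p ≡ q) →
            {u v : Σ X P} → proj₁ u ≡ proj₁ v → u ≡ v
Σ-≡-proj₁ irr {x , p} {.x , q} refl = cong (x ,_) (irr p q)

equations-irrelevant : ∀ {A B C D : Set} {a a′ : A} {b b′ : B} {c c′ : C} {d d′ : D}
  (p q : (a ≡ a′) × (b ≡ b′) × (c ≡ c′) × (d ≡ d′)) → p ≡ q
equations-irrelevant (p₁ , p₂ , p₃ , p₄) (q₁ , q₂ , q₃ , q₄)
  rewrite uip p₁ q₁ | uip p₂ q₂ | uip p₃ q₃ | uip p₄ q₄ = refl

DT-≡ : ∀ {n k l} {u v : DT n k l} → proj₁ u ≡ proj₁ v → u ≡ v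
DT-≡ = Σ-≡-proj₁ equations-irrelevant

SepPerm-≡ : ∀ {n a b} {u v : SepPerm n a b} → proj₁ u ≡ proj₁ v → u ≡ v
SepPerm-≡ = Σ-≡-proj₁ equations-irrelevant

rootOK : ∀ s l r → isDiSk (node s l r) ≡ true → rightOK s r ≡ true
rootOK s l r d = proj₁ (∧-true⁻ d)

leftDiSk : ∀ s l r → isDiSk (node s l r) ≡ true → isDiSk l ≡ true
leftDiSk s l r d = proj₁ (∧-true⁻ (proj₂ (∧-true⁻ {rightOK s r} d)))

rightDiSk : ∀ s l r → isDiSk (node s l r) ≡ true → isDiSk r ≡ true
rightDiSk s l r d = proj₂ (∧-true⁻ {isDiSk l} (proj₂ (∧-true⁻ {rightOK s r} d)))

node-diSk : ∀ s l r → rightOK s r ≡ true → isDiSk l ≡ true → isDiSk r ≡ true →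
            isDiSk (node s l r) ≡ true
node-diSk s l r ok dl dr = ∧-true⁺ ok (∧-true⁺ dl dr)

initialRun-++ : ∀ s xs {ys} → initialRun s ys ≡ 0 → initialRun s (xs ++ ys) ≡ initialRun s xs
initialRun-++ s [] p = p
initialRun-++ ⊕ (⊕ ∷ xs) p = cong suc (initialRun-++ ⊕ xs p)
initialRun-++ ⊕ (⊖ ∷ xs) p = refl
initialRun-++ ⊖ (⊕ ∷ xs) p = refl
initialRun-++ ⊖ (⊖ ∷ xs) p = cong suc (initialRun-++ ⊖ xs p)

top-node⊕ : ∀ l r → rightOK ⊕ r ≡ true → top (node ⊕ l r) ≡ suc (top l)
top-node⊕ l leaf _ = cong suc (initialRun-++ ⊕ (preorder l) refl)
top-node⊕ l (node ⊖ _ _) _ = cong suc (initialRun-++ ⊕ (preorder l) refl)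

iom-node⊕ : ∀ l r → iom (node ⊕ l r) ≡ iom l
iom-node⊕ l r = initialRun-++ ⊖ (inorder l) refl

data NotPlus : BTree → Set where
  leaf : NotPlus leaf
  node⊖ : ∀ l r → NotPlus (node ⊖ l r)

top-NotPlus : ∀ {T} → NotPlus T → top T ≡ 0
top-NotPlus leaf = refl
top-NotPlus (node⊖ _ _) = refl

-- The bijection ψ

flipLabel : Label → Label
flipLabel ⊕ = ⊖
flipLabel ⊖ = ⊕

flipLabels : BTree → BTree
flipLabels leaf = leaf
flipLabels (node s l r) = node (flipLabel s) (flipLabels l) (flipLabels r)

hang : BTree → BTree → BTree
hang leaf Y = node ⊖ leaf Y
hang (node s l r) Y = node s (hang l Y) r

unhang : BTree → BTree × BTree
unhang leaf = leaf , leaf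
unhang (node s leaf r) = leaf , r
unhang (node s l@(node _ _ _) r) = Prod.map₁ (λ V → node s V r) (unhang l)

swapBase : BTree → BTree → BTree × BTree
swapBase (node ⊕ l r) L = Prod.map₂ (λ W → node ⊕ W r) (swapBase l L)
swapBase leaf L = leaf , L
swapBase (node ⊖ l r) L = node ⊖ l r , L

reattach : BTree × BTree → BTree → BTree
reattach (V , W) R₂ = hang V (node ⊕ W (flipLabels R₂))

ψ : BTree → BTree
ψ (node ⊕ l@(node ⊕ _ _) r) = node ⊕ (ψ l) r
ψ (node ⊕ L leaf) = hang L leaf
ψ (node ⊕ L (node ⊖ R₁ R₂)) = reattach (swapBase R₁ L) R₂
ψ T = T

unreattach : BTree × BTree → BTree
unreattach (V , leaf) = node ⊕ V leaf
unreattach (V , node ⊕ W R₂) =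
  node ⊕ (proj₁ (swapBase W V)) (node ⊖ (proj₂ (swapBase W V)) (flipLabels R₂))
unreattach (V , node ⊖ _ _) = leaf

-- ψ is only meaningful on ⊕-rooted trees and ψ⁻¹ on trees whose leftmost node is ⊖;
-- the remaining clauses, and the ⊖ case of unreattach, are junk.
ψ⁻¹ : BTree → BTree
ψ⁻¹ (node ⊕ S R) = node ⊕ (ψ⁻¹ S) R
ψ⁻¹ S = unreattach (unhang S)

data RootView : BTree → Set where
  plus : ∀ l r → RootView (node ⊕ l r)
  notPlus : ∀ {T} → NotPlus T → RootView T

rootView : ∀ T → RootView T
rootView leaf = notPlus leaf
rootView (node ⊕ l r) = plus l r
rootView (node ⊖ l r) = notPlus (node⊖ l r)

+-right-comm : ∀ a b c → a + b + c ≡ a + c + b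
+-right-comm a b c = trans (+-assoc a b c) (trans (cong (a +_) (+-comm b c)) (sym (+-assoc a c b)))

+-suc-+ : ∀ a b c → a + suc (b + c) ≡ suc (a + b + c)
+-suc-+ a b c = trans (+-suc a (b + c)) (cong suc (sym (+-assoc a b c)))

size-flipLabels : ∀ T → size (flipLabels T) ≡ size T
size-flipLabels leaf = refl
size-flipLabels (node s l r) = cong suc (cong₂ _+_ (size-flipLabels l) (size-flipLabels r))

rightOK-flipLabels : ∀ s r → rightOK (flipLabel s) (flipLabels r) ≡ rightOK s r
rightOK-flipLabels s leaf = refl
rightOK-flipLabels ⊕ (node ⊕ _ _) = refl
rightOK-flipLabels ⊕ (node ⊖ _ _) = refl
rightOK-flipLabels ⊖ (node ⊕ _ _) = refl
rightOK-flipLabels ⊖ (node ⊖ _ _) = refl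

isDiSk-flipLabels : ∀ T → isDiSk (flipLabels T) ≡ isDiSk T
isDiSk-flipLabels leaf = refl
isDiSk-flipLabels (node s l r)
  rewrite rightOK-flipLabels s r | isDiSk-flipLabels l | isDiSk-flipLabels r = refl

flipLabels-involutive : ∀ T → flipLabels (flipLabels T) ≡ T
flipLabels-involutive leaf = refl
flipLabels-involutive (node ⊕ l r) = cong₂ (node ⊕) (flipLabels-involutive l) (flipLabels-involutive r)
flipLabels-involutive (node ⊖ l r) = cong₂ (node ⊖) (flipLabels-involutive l) (flipLabels-involutive r)

size-hang : ∀ V Y → size (hang V Y) ≡ suc (size V + size Y)
size-hang leaf Y = refl
size-hang (node s l r) Y =
  cong suc (trans (cong (_+ size r) (size-hang l Y)) (cong suc (+-right-comm (size l) (size Y) (size r))))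

inorder-hang : ∀ V Y → inorder (hang V Y) ≡ ⊖ ∷ inorder Y ++ inorder V
inorder-hang leaf Y = cong (⊖ ∷_) (sym (++-identityʳ (inorder Y)))
inorder-hang (node s l r) Y rewrite inorder-hang l Y =
  cong (⊖ ∷_) (++-assoc (inorder Y) (inorder l) (s ∷ inorder r))

top-hang : ∀ {V} Y → NotPlus V → top (hang V Y) ≡ 0
top-hang Y leaf = refl
top-hang Y (node⊖ _ _) = refl

iom-hang-leaf : ∀ V → iom (hang V leaf) ≡ suc (iom V)
iom-hang-leaf V rewrite inorder-hang V leaf = refl

iom-hang-node⊕ : ∀ V W F → iom (hang V (node ⊕ W F)) ≡ suc (iom W)
iom-hang-node⊕ V W F
  rewrite inorder-hang V (node ⊕ W F) | ++-assoc (inorder W) (⊕ ∷ inorder F) (inorder V) =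
  cong suc (initialRun-++ ⊖ (inorder W) refl)

isDiSk-hang⁺ : ∀ V Y → isDiSk V ≡ true → isDiSk Y ≡ true → rightOK ⊖ Y ≡ true →
               isDiSk (hang V Y) ≡ true
isDiSk-hang⁺ leaf Y _ dY ok = node-diSk ⊖ leaf Y ok refl dY
isDiSk-hang⁺ (node s l r) Y dV dY ok =
  node-diSk s (hang l Y) r (rootOK s l r dV) (isDiSk-hang⁺ l Y (leftDiSk s l r dV) dY ok) (rightDiSk s l r dV)

isDiSk-hang⁻ : ∀ V Y → isDiSk (hang V Y) ≡ true →
               isDiSk V ≡ true × isDiSk Y ≡ true × rightOK ⊖ Y ≡ true
isDiSk-hang⁻ leaf Y d = refl , rightDiSk ⊖ leaf Y d , rootOK ⊖ leaf Y d
isDiSk-hang⁻ (node s l r) Y d =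
  let dl , dY , ok = isDiSk-hang⁻ l Y (leftDiSk s (hang l Y) r d) in
  node-diSk s l r (rootOK s (hang l Y) r d) dl (rightDiSk s (hang l Y) r d) , dY , ok

unhang-hang : ∀ V Y → unhang (hang V Y) ≡ (V , Y)
unhang-hang leaf Y = refl
unhang-hang (node s leaf r) Y = refl
unhang-hang (node s l@(node _ _ _) r) Y rewrite unhang-hang l Y = refl

initialRun-pos-++ : ∀ s xs y ys zs → 1 ≤ initialRun s ((xs ++ y ∷ ys) ++ zs) →
                    1 ≤ initialRun s (xs ++ y ∷ ys)
initialRun-pos-++ ⊕ [] ⊕ ys zs p = s≤s z≤n
initialRun-pos-++ ⊖ [] ⊖ ys zs p = s≤s z≤n
initialRun-pos-++ ⊕ (⊕ ∷ xs) y ys zs p = s≤s z≤n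
initialRun-pos-++ ⊖ (⊖ ∷ xs) y ys zs p = s≤s z≤n

hang-unhang : ∀ S → 1 ≤ iom S → hang (proj₁ (unhang S)) (proj₂ (unhang S)) ≡ S
hang-unhang (node ⊖ leaf r) _ = refl
hang-unhang (node s (node s′ a b) r) p = cong (λ V → node s V r)
  (hang-unhang (node s′ a b) (initialRun-pos-++ ⊖ (inorder a) s′ (inorder b) (s ∷ inorder r) p))

unhang-NotPlus : ∀ l r → NotPlus (proj₁ (unhang (node ⊖ l r)))
unhang-NotPlus leaf r = leaf
unhang-NotPlus (node _ _ _) r = node⊖ _ _

swapBase-NotPlus : ∀ R L → NotPlus (proj₁ (swapBase R L))
swapBase-NotPlus (node ⊕ l r) L = swapBase-NotPlus l L
swapBase-NotPlus leaf L = leaf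
swapBase-NotPlus (node ⊖ l r) L = node⊖ l r

size-swapBase : ∀ R L → size (proj₁ (swapBase R L)) + size (proj₂ (swapBase R L)) ≡ size R + size L
size-swapBase leaf L = refl
size-swapBase (node ⊖ l r) L = refl
size-swapBase (node ⊕ l r) L =
  trans (+-suc-+ (size V) (size W) (size r))
        (cong suc (trans (cong (_+ size r) (size-swapBase l L)) (+-right-comm (size l) (size L) (size r))))
  where
  V = proj₁ (swapBase l L)
  W = proj₂ (swapBase l L)

isDiSk-swapBase : ∀ R L → isDiSk R ≡ true → isDiSk L ≡ true →
                  isDiSk (proj₁ (swapBase R L)) ≡ true × isDiSk (proj₂ (swapBase R L)) ≡ true
isDiSk-swapBase leaf L _ dL = refl , dL
isDiSk-swapBase (node ⊖ l r) L dR dL = dR , dL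
isDiSk-swapBase (node ⊕ l r) L dR dL =
  let dV , dW = isDiSk-swapBase l L (leftDiSk ⊕ l r dR) dL in
  dV , node-diSk ⊕ (proj₂ (swapBase l L)) r (rootOK ⊕ l r dR) dW (rightDiSk ⊕ l r dR)

iom-swapBase : ∀ R L → iom (proj₂ (swapBase R L)) ≡ iom L
iom-swapBase leaf L = refl
iom-swapBase (node ⊖ l r) L = refl
iom-swapBase (node ⊕ l r) L = trans (iom-node⊕ (proj₂ (swapBase l L)) r) (iom-swapBase l L)

swapBase-involutive : ∀ R {L} → NotPlus L →
  swapBase (proj₂ (swapBase R L)) (proj₁ (swapBase R L)) ≡ (L , R)
swapBase-involutive (node ⊕ l r) np rewrite swapBase-involutive l np = refl
swapBase-involutive leaf leaf = refl
swapBase-involutive leaf (node⊖ _ _) = refl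
swapBase-involutive (node ⊖ l r) leaf = refl
swapBase-involutive (node ⊖ l r) (node⊖ _ _) = refl

record Shifted (T X : BTree) : Set where
  field
    diSk : isDiSk X ≡ true
    size-≡ : size X ≡ size T
    top-≡ : suc (top X) ≡ top T
    iom-≡ : iom X ≡ suc (iom T)

ψ-leaf : ∀ {L} → NotPlus L → ψ (node ⊕ L leaf) ≡ hang L leaf
ψ-leaf leaf = refl
ψ-leaf (node⊖ _ _) = refl

ψ-node⊖ : ∀ {L} R₁ R₂ → NotPlus L → ψ (node ⊕ L (node ⊖ R₁ R₂)) ≡ reattach (swapBase R₁ L) R₂
ψ-node⊖ R₁ R₂ leaf = refl
ψ-node⊖ R₁ R₂ (node⊖ _ _) = refl

top-node⊕-NotPlus : ∀ {L} R → NotPlus L → rightOK ⊕ R ≡ true → top (node ⊕ L R) ≡ 1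
top-node⊕-NotPlus {L} R np ok = trans (top-node⊕ L R ok) (cong suc (top-NotPlus np))

hang-Shifted : ∀ {L} → NotPlus L → isDiSk L ≡ true → Shifted (node ⊕ L leaf) (hang L leaf)
hang-Shifted {L} np dL = record
  { diSk = isDiSk-hang⁺ L leaf dL refl refl
  ; size-≡ = size-hang L leaf
  ; top-≡ = trans (cong suc (top-hang leaf np)) (sym (top-node⊕-NotPlus leaf np refl))
  ; iom-≡ = trans (iom-hang-leaf L) (cong suc (sym (iom-node⊕ L leaf)))
  }

reattach-Shifted : ∀ {L} R₁ R₂ → NotPlus L → isDiSk (node ⊕ L (node ⊖ R₁ R₂)) ≡ true →
                   Shifted (node ⊕ L (node ⊖ R₁ R₂)) (reattach (swapBase R₁ L) R₂)
reattach-Shifted {L} R₁ R₂ np d = record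
  { diSk = isDiSk-hang⁺ V (node ⊕ W F) dV (node-diSk ⊕ W F okF dW dF) refl
  ; size-≡ = trans (size-hang V (node ⊕ W F)) (cong suc sizes)
  ; top-≡ = trans (cong suc (top-hang (node ⊕ W F) (swapBase-NotPlus R₁ L)))
                  (sym (top-node⊕-NotPlus R np refl))
  ; iom-≡ = trans (iom-hang-node⊕ V W F) (cong suc (trans (iom-swapBase R₁ L) (sym (iom-node⊕ L R))))
  }
  where
  R = node ⊖ R₁ R₂
  V = proj₁ (swapBase R₁ L)
  W = proj₂ (swapBase R₁ L)
  F = flipLabels R₂
  dR = rightDiSk ⊕ L R d
  dV = proj₁ (isDiSk-swapBase R₁ L (leftDiSk ⊖ R₁ R₂ dR) (leftDiSk ⊕ L R d))
  dW = proj₂ (isDiSk-swapBase R₁ L (leftDiSk ⊖ R₁ R₂ dR) (leftDiSk ⊕ L R d))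
  dF = trans (isDiSk-flipLabels R₂) (rightDiSk ⊖ R₁ R₂ dR)
  okF = trans (rightOK-flipLabels ⊖ R₂) (rootOK ⊖ R₁ R₂ dR)
  sizes : size V + size (node ⊕ W F) ≡ size L + size R
  sizes = begin
    size V + suc (size W + size F)  ≡⟨ cong (λ z → size V + suc (size W + z)) (size-flipLabels R₂) ⟩
    size V + suc (size W + size R₂) ≡⟨ +-suc-+ (size V) (size W) (size R₂) ⟩
    suc (size V + size W + size R₂) ≡⟨ cong (λ z → suc (z + size R₂)) (size-swapBase R₁ L) ⟩
    suc (size R₁ + size L + size R₂) ≡⟨ cong (λ z → suc (z + size R₂)) (+-comm (size R₁) (size L)) ⟩
    suc (size L + size R₁ + size R₂) ≡⟨ sym (+-suc-+ (size L) (size R₁) (size R₂)) ⟩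
    size L + size R ∎
    where open ≡-Reasoning

ψ-Shifted-NotPlus : ∀ {L} → NotPlus L → ∀ R → isDiSk (node ⊕ L R) ≡ true →
                    Shifted (node ⊕ L R) (ψ (node ⊕ L R))
ψ-Shifted-NotPlus {L} np leaf d =
  subst (Shifted (node ⊕ L leaf)) (sym (ψ-leaf np)) (hang-Shifted np (leftDiSk ⊕ L leaf d))
ψ-Shifted-NotPlus {L} np (node ⊖ R₁ R₂) d =
  subst (Shifted (node ⊕ L (node ⊖ R₁ R₂))) (sym (ψ-node⊖ R₁ R₂ np)) (reattach-Shifted R₁ R₂ np d)
ψ-Shifted-NotPlus {L} np (node ⊕ R₁ R₂) d = ⊥-elim (false≢true (rootOK ⊕ L (node ⊕ R₁ R₂) d))

ψ-Shifted-node⊕ : ∀ L R → isDiSk (node ⊕ L R) ≡ true → Shifted (node ⊕ L R) (ψ (node ⊕ L R))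
ψ-Shifted-node⊕ L R d with rootView L
... | notPlus np = ψ-Shifted-NotPlus np R d
... | plus a b = record
  { diSk = node-diSk ⊕ (ψ L) R ok (Shifted.diSk ih) (rightDiSk ⊕ L R d)
  ; size-≡ = cong (λ z → suc (z + size R)) (Shifted.size-≡ ih)
  ; top-≡ = trans (cong suc (top-node⊕ (ψ L) R ok))
                  (trans (cong suc (Shifted.top-≡ ih)) (sym (top-node⊕ L R ok)))
  ; iom-≡ = trans (iom-node⊕ (ψ L) R) (trans (Shifted.iom-≡ ih) (cong suc (sym (iom-node⊕ L R))))
  }
  where
  ok = rootOK ⊕ L R d
  ih = ψ-Shifted-node⊕ a b (leftDiSk ⊕ L R d)

ψ⁻¹-hang : ∀ {V} Y → NotPlus V → ψ⁻¹ (hang V Y) ≡ unreattach (V , Y)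
ψ⁻¹-hang Y leaf = refl
ψ⁻¹-hang Y (node⊖ a b) rewrite unhang-hang (node ⊖ a b) Y = refl

ψ⁻¹-ψ-NotPlus : ∀ {L} → NotPlus L → ∀ R → isDiSk (node ⊕ L R) ≡ true →
                ψ⁻¹ (ψ (node ⊕ L R)) ≡ node ⊕ L R
ψ⁻¹-ψ-NotPlus np leaf _ rewrite ψ-leaf np = ψ⁻¹-hang leaf np
ψ⁻¹-ψ-NotPlus {L} np (node ⊖ R₁ R₂) _
  rewrite ψ-node⊖ R₁ R₂ np
        | ψ⁻¹-hang (node ⊕ (proj₂ (swapBase R₁ L)) (flipLabels R₂)) (swapBase-NotPlus R₁ L)
        | swapBase-involutive R₁ np | flipLabels-involutive R₂ = refl
ψ⁻¹-ψ-NotPlus {L} np (node ⊕ R₁ R₂) d = ⊥-elim (false≢true (rootOK ⊕ L (node ⊕ R₁ R₂) d))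

ψ⁻¹-ψ-node⊕ : ∀ L R → isDiSk (node ⊕ L R) ≡ true → ψ⁻¹ (ψ (node ⊕ L R)) ≡ node ⊕ L R
ψ⁻¹-ψ-node⊕ L R d with rootView L
... | notPlus np = ψ⁻¹-ψ-NotPlus np R d
... | plus a b = cong (λ X → node ⊕ X R) (ψ⁻¹-ψ-node⊕ a b (leftDiSk ⊕ L R d))

PlusPreimage : BTree → Set
PlusPreimage S = Σ BTree λ a → Σ BTree λ b →
  ψ⁻¹ S ≡ node ⊕ a b × isDiSk (node ⊕ a b) ≡ true × ψ (node ⊕ a b) ≡ S

unreattach-PlusPreimage : ∀ {V} Y → NotPlus V → isDiSk (hang V Y) ≡ true →
                          PlusPreimage (hang V Y)
unreattach-PlusPreimage {V} leaf np d =
  V , leaf , ψ⁻¹-hang leaf np , node-diSk ⊕ V leaf refl (proj₁ (isDiSk-hang⁻ V leaf d)) refl , ψ-leaf np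
unreattach-PlusPreimage {V} (node ⊕ Y₁ Y₂) np d =
  L , node ⊖ R₁ (flipLabels Y₂) , ψ⁻¹-hang (node ⊕ Y₁ Y₂) np ,
  node-diSk ⊕ L (node ⊖ R₁ (flipLabels Y₂)) refl dL (node-diSk ⊖ R₁ (flipLabels Y₂) ok dR₁ dF) ,
  trans (ψ-node⊖ R₁ (flipLabels Y₂) (swapBase-NotPlus Y₁ V)) back
  where
  L = proj₁ (swapBase Y₁ V)
  R₁ = proj₂ (swapBase Y₁ V)
  dV = proj₁ (isDiSk-hang⁻ V (node ⊕ Y₁ Y₂) d)
  dY = proj₁ (proj₂ (isDiSk-hang⁻ V (node ⊕ Y₁ Y₂) d))
  dL = proj₁ (isDiSk-swapBase Y₁ V (leftDiSk ⊕ Y₁ Y₂ dY) dV)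
  dR₁ = proj₂ (isDiSk-swapBase Y₁ V (leftDiSk ⊕ Y₁ Y₂ dY) dV)
  dF = trans (isDiSk-flipLabels Y₂) (rightDiSk ⊕ Y₁ Y₂ dY)
  ok = trans (rightOK-flipLabels ⊕ Y₂) (rootOK ⊕ Y₁ Y₂ dY)
  back : reattach (swapBase R₁ L) (flipLabels Y₂) ≡ hang V (node ⊕ Y₁ Y₂)
  back rewrite swapBase-involutive Y₁ np | flipLabels-involutive Y₂ = refl
unreattach-PlusPreimage {V} (node ⊖ Y₁ Y₂) np d =
  ⊥-elim (false≢true (proj₂ (proj₂ (isDiSk-hang⁻ V (node ⊖ Y₁ Y₂) d))))

ψ⁻¹-PlusPreimage : ∀ S → isDiSk S ≡ true → 1 ≤ iom S → PlusPreimage S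
ψ⁻¹-PlusPreimage (node ⊕ S R) d p =
  let a , b , e , dab , ψab = ψ⁻¹-PlusPreimage S (leftDiSk ⊕ S R d) (subst (1 ≤_) (iom-node⊕ S R) p) in
  ψ⁻¹ S , R , refl ,
  node-diSk ⊕ (ψ⁻¹ S) R (rootOK ⊕ S R d) (subst (λ X → isDiSk X ≡ true) (sym e) dab) (rightDiSk ⊕ S R d) ,
  subst (λ X → ψ (node ⊕ X R) ≡ node ⊕ S R) (sym e) (cong (λ X → node ⊕ X R) ψab)
ψ⁻¹-PlusPreimage S@(node ⊖ l r) d p =
  subst PlusPreimage (hang-unhang S p)
    (unreattach-PlusPreimage (proj₂ (unhang S)) (unhang-NotPlus l r)
      (subst (λ X → isDiSk X ≡ true) (sym (hang-unhang S p)) d))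

ψ-Shifted : ∀ T → isDiSk T ≡ true → 1 ≤ top T → Shifted T (ψ T)
ψ-Shifted (node ⊕ L R) d _ = ψ-Shifted-node⊕ L R d

ψ⁻¹-ψ : ∀ T → isDiSk T ≡ true → 1 ≤ top T → ψ⁻¹ (ψ T) ≡ T
ψ⁻¹-ψ (node ⊕ L R) d _ = ψ⁻¹-ψ-node⊕ L R d

ψ-DT : ∀ n k l → 1 ≤ k → DT n k l ↔ DT n (k ∸ 1) (l + 1)
ψ-DT n (suc k) l _ =
  mk↔ₛ′ to from (λ y → DT-≡ (ψ-ψ⁻¹ y)) (λ (T , d , _ , t , _) → DT-≡ (ψ⁻¹-ψ T d (top-pos T t)))
  where
  top-pos : ∀ T → top T ≡ suc k → 1 ≤ top T
  top-pos _ t = subst (1 ≤_) (sym t) (s≤s z≤n)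

  to : DT n (suc k) l → DT n k (l + 1)
  to (T , d , s , t , i) =
    let open Shifted (ψ-Shifted T d (top-pos T t)) in
    ψ T , diSk , trans (cong suc size-≡) s , suc-injective (trans top-≡ t) ,
    trans iom-≡ (trans (cong suc i) (+-comm 1 l))

  preimage : (y : DT n k (l + 1)) → PlusPreimage (proj₁ y)
  preimage (S , d , _ , _ , i) = ψ⁻¹-PlusPreimage S d (subst (1 ≤_) (sym (trans i (+-comm l 1))) (s≤s z≤n))

  from : DT n k (l + 1) → DT n (suc k) l
  from y@(S , d , s , t , i) =
    let a , b , e , dab , ψab = preimage y
        open Shifted (ψ-Shifted-node⊕ a b dab)
    in
    ψ⁻¹ S , subst (λ X → isDiSk X ≡ true) (sym e) dab ,
    trans (cong suc (trans (cong size e) (trans (sym size-≡) (cong size ψab)))) s ,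
    trans (cong top e) (trans (sym top-≡) (cong suc (trans (cong top ψab) t))) ,
    suc-injective (trans (cong (λ X → suc (iom X)) e)
                         (trans (sym iom-≡) (trans (cong iom ψab) (trans i (+-comm l 1)))))

  ψ-ψ⁻¹ : ∀ y → ψ (ψ⁻¹ (proj₁ y)) ≡ proj₁ y
  ψ-ψ⁻¹ y = let _ , _ , e , _ , ψab = preimage y in trans (cong ψ e) ψab

<ᵇ-true : ∀ {a b} → a < b → (a <ᵇ b) ≡ true
<ᵇ-true p = Equivalence.to T-≡ (<⇒<ᵇ p)

<ᵇ-false : ∀ {a b} → b ≤ a → (a <ᵇ b) ≡ false
<ᵇ-false {b = zero} _ = refl
<ᵇ-false {suc a} {suc b} (s≤s p) = <ᵇ-false p

<ᵇ-true⁻ : ∀ a b → (a <ᵇ b) ≡ true → a < b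
<ᵇ-true⁻ a b e = <ᵇ⇒< a b (Equivalence.from T-≡ e)

<ᵇ-false⁻ : ∀ a b → (a <ᵇ b) ≡ false → b ≤ a
<ᵇ-false⁻ a b e = ≮⇒≥ (λ p → false≢true (trans (sym e) (<ᵇ-true p)))

≡ᵇ-true⁻ : ∀ a b → (a ≡ᵇ b) ≡ true → a ≡ b
≡ᵇ-true⁻ a b e = ≡ᵇ⇒≡ a b (Equivalence.from T-≡ e)

≡ᵇ-refl : ∀ a → (a ≡ᵇ a) ≡ true
≡ᵇ-refl zero = refl
≡ᵇ-refl (suc a) = ≡ᵇ-refl a

elem-true⇒∈ : ∀ x xs → elem x xs ≡ true → x ∈ xs
elem-true⇒∈ x (y ∷ ys) e with x ≡ᵇ y in eq
... | true = here (≡ᵇ-true⁻ x y eq)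
... | false = there (elem-true⇒∈ x ys e)

∈⇒elem-true : ∀ {x xs} → x ∈ xs → elem x xs ≡ true
∈⇒elem-true {x} (here refl) rewrite ≡ᵇ-refl x = refl
∈⇒elem-true {x} {y ∷ _} (there p) with x ≡ᵇ y
... | true = refl
... | false = ∈⇒elem-true p

elem-false⇒All≢ : ∀ x xs → elem x xs ≡ false → All (x ≢_) xs
elem-false⇒All≢ x [] _ = []
elem-false⇒All≢ x (y ∷ ys) e with x ≡ᵇ y in eq
... | false = (λ { refl → false≢true (trans (sym eq) (≡ᵇ-refl x)) }) ∷ elem-false⇒All≢ x ys e

All≢⇒elem-false : ∀ x xs → All (x ≢_) xs → elem x xs ≡ false
All≢⇒elem-false x [] _ = refl
All≢⇒elem-false x (y ∷ ys) (x≢y ∷ ps) with x ≡ᵇ y in eq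
... | true = ⊥-elim (x≢y (≡ᵇ-true⁻ x y eq))
... | false = All≢⇒elem-false x ys ps

distinct⇒Unique : ∀ xs → distinct xs ≡ true → Unique xs
distinct⇒Unique [] _ = []
distinct⇒Unique (x ∷ xs) e with elem x xs in eq
... | false = elem-false⇒All≢ x xs eq ∷ distinct⇒Unique xs e

Unique⇒distinct : ∀ {xs} → Unique xs → distinct xs ≡ true
Unique⇒distinct {[]} [] = refl
Unique⇒distinct {x ∷ xs} (x≢xs ∷ u) rewrite All≢⇒elem-false x xs x≢xs = Unique⇒distinct u

allB⇒All : ∀ {A : Set} (p : A → Bool) xs → allB p xs ≡ true → All (λ x → p x ≡ true) xs
allB⇒All p [] _ = []
allB⇒All p (x ∷ xs) e = proj₁ (∧-true⁻ e) ∷ allB⇒All p xs (proj₂ (∧-true⁻ {p x} e))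

All⇒allB : ∀ {A : Set} (p : A → Bool) {xs} → All (λ x → p x ≡ true) xs → allB p xs ≡ true
All⇒allB p [] = refl
All⇒allB p (q ∷ qs) = ∧-true⁺ q (All⇒allB p qs)

InRange : ℕ → ℕ → Set
InRange n x = 1 ≤ x × x ≤ n

elem-oneTo⇒InRange : ∀ n x → elem x (oneTo n) ≡ true → InRange n x
elem-oneTo⇒InRange n x e with ∈-map⁻ suc (elem-true⇒∈ x (oneTo n) e)
... | i , i∈ , refl = s≤s z≤n , ∈-upTo⁻ i∈

InRange⇒elem-oneTo : ∀ n x → InRange n x → elem x (oneTo n) ≡ true
InRange⇒elem-oneTo n (suc i) (_ , i<n) = ∈⇒elem-true (∈-map⁺ suc (∈-upTo⁺ i<n))

record IsPerm (n : ℕ) (π : List ℕ) : Set where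
  field
    length-≡ : length π ≡ n
    unique : Unique π
    inRange : All (InRange n) π

isPerm⇒IsPerm : ∀ n π → isPerm n π ≡ true → IsPerm n π
isPerm⇒IsPerm n π e = record
  { length-≡ = ≡ᵇ-true⁻ (length π) n (proj₁ (∧-true⁻ e))
  ; unique = distinct⇒Unique π (proj₁ (∧-true⁻ rest))
  ; inRange = All.map (λ {x} → elem-oneTo⇒InRange n x)
                      (allB⇒All _ π (proj₂ (∧-true⁻ {distinct π} rest)))
  }
  where rest = proj₂ (∧-true⁻ {length π ≡ᵇ n} e)

IsPerm⇒isPerm : ∀ n π → IsPerm n π → isPerm n π ≡ true
IsPerm⇒isPerm n π p rewrite IsPerm.length-≡ p | ≡ᵇ-refl n =
  ∧-true⁺ (Unique⇒distinct (IsPerm.unique p))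
          (All⇒allB _ (All.map (λ {x} → InRange⇒elem-oneTo n x) (IsPerm.inRange p)))

Occ2413 Occ3142 : ℕ → ℕ → ℕ → ℕ → Set
Occ2413 a b c d = a < b × c ≤ a × a < d × c ≤ b × d ≤ b × c < d
Occ3142 a b c d = b ≤ a × a < c × d ≤ a × b < c × b < d × d ≤ c

ContainsForbidden : List ℕ → Set
ContainsForbidden π = ∃[ a ] ∃[ b ] ∃[ c ] ∃[ d ]
  (a ∷ b ∷ c ∷ d ∷ []) ⊆ π × (Occ2413 a b c d ⊎ Occ3142 a b c d)

ContainsForbidden-⊆ : ∀ {xs ys} → xs ⊆ ys → ContainsForbidden xs → ContainsForbidden ys
ContainsForbidden-⊆ xs⊆ys (a , b , c , d , occ , p) = a , b , c , d , ⊆-trans occ xs⊆ys , p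

orderIso-2413⁻ : ∀ a b c d → orderIso (a ∷ b ∷ c ∷ d ∷ []) (2 ∷ 4 ∷ 1 ∷ 3 ∷ []) ≡ true → Occ2413 a b c d
orderIso-2413⁻ a b c d
  with a <ᵇ b in e₁ | a <ᵇ c in e₂ | a <ᵇ d in e₃ | b <ᵇ c in e₄ | b <ᵇ d in e₅ | c <ᵇ d in e₆
... | true | false | true | false | false | true = λ _ →
  <ᵇ-true⁻ a b e₁ , <ᵇ-false⁻ a c e₂ , <ᵇ-true⁻ a d e₃ , <ᵇ-false⁻ b c e₄ , <ᵇ-false⁻ b d e₅ , <ᵇ-true⁻ c d e₆
... | false | _ | _ | _ | _ | _ = λ ()
... | true | true | _ | _ | _ | _ = λ ()
... | true | false | false | _ | _ | _ = λ ()
... | true | false | true | true | _ | _ = λ ()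
... | true | false | true | false | true | _ = λ ()
... | true | false | true | false | false | false = λ ()

orderIso-3142⁻ : ∀ a b c d → orderIso (a ∷ b ∷ c ∷ d ∷ []) (3 ∷ 1 ∷ 4 ∷ 2 ∷ []) ≡ true → Occ3142 a b c d
orderIso-3142⁻ a b c d
  with a <ᵇ b in e₁ | a <ᵇ c in e₂ | a <ᵇ d in e₃ | b <ᵇ c in e₄ | b <ᵇ d in e₅ | c <ᵇ d in e₆
... | false | true | false | true | true | false = λ _ →
  <ᵇ-false⁻ a b e₁ , <ᵇ-true⁻ a c e₂ , <ᵇ-false⁻ a d e₃ , <ᵇ-true⁻ b c e₄ , <ᵇ-true⁻ b d e₅ , <ᵇ-false⁻ c d e₆
... | true | _ | _ | _ | _ | _ = λ ()
... | false | false | _ | _ | _ | _ = λ ()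
... | false | true | true | _ | _ | _ = λ ()
... | false | true | false | false | _ | _ = λ ()
... | false | true | false | true | false | _ = λ ()
... | false | true | false | true | true | true = λ ()

orderIso-2413⁺ : ∀ {a b c d} → Occ2413 a b c d → orderIso (a ∷ b ∷ c ∷ d ∷ []) (2 ∷ 4 ∷ 1 ∷ 3 ∷ []) ≡ true
orderIso-2413⁺ (p₁ , p₂ , p₃ , p₄ , p₅ , p₆)
  rewrite <ᵇ-true p₁ | <ᵇ-false p₂ | <ᵇ-true p₃ | <ᵇ-false p₄ | <ᵇ-false p₅ | <ᵇ-true p₆ = refl

orderIso-3142⁺ : ∀ {a b c d} → Occ3142 a b c d → orderIso (a ∷ b ∷ c ∷ d ∷ []) (3 ∷ 1 ∷ 4 ∷ 2 ∷ []) ≡ true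
orderIso-3142⁺ (p₁ , p₂ , p₃ , p₄ , p₅ , p₆)
  rewrite <ᵇ-false p₁ | <ᵇ-true p₂ | <ᵇ-false p₃ | <ᵇ-true p₄ | <ᵇ-true p₅ | <ᵇ-false p₆ = refl

subseqs-complete : ∀ {s xs} → s ⊆ xs → s ∈ subseqs (length s) xs
subseqs-complete {[]} {[]} [] = here refl
subseqs-complete {[]} {_ ∷ _} _ = here refl
subseqs-complete {_ ∷ s} (y ∷ʳ p) = ∈-++⁺ʳ (map (y ∷_) (subseqs (length s) _)) (subseqs-complete p)
subseqs-complete {_ ∷ _} (refl ∷ p) = ∈-++⁺ˡ (∈-map⁺ (_ ∷_) (subseqs-complete p))

subseqs-sound : ∀ k s xs → s ∈ subseqs k xs → s ⊆ xs × length s ≡ k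
subseqs-sound zero s xs (here refl) = []⊆-universal xs , refl
subseqs-sound (suc k) s (x ∷ xs) p with ∈-++⁻ (map (x ∷_) (subseqs k xs)) p
... | inj₁ q with ∈-map⁻ (x ∷_) q
...   | s′ , q′ , refl = let s′⊆xs , len = subseqs-sound k s′ xs q′ in refl ∷ s′⊆xs , cong suc len
subseqs-sound (suc k) s (x ∷ xs) p | inj₂ q =
  let s⊆xs , len = subseqs-sound (suc k) s xs q in x ∷ʳ s⊆xs , len

anyB⇒∃ : ∀ {A : Set} (p : A → Bool) xs → anyB p xs ≡ true → ∃[ x ] x ∈ xs × p x ≡ true
anyB⇒∃ p (x ∷ xs) e with p x in eq
... | true = x , here refl , eq
... | false = let y , y∈ , py = anyB⇒∃ p xs e in y , there y∈ , py

∃⇒anyB : ∀ {A : Set} (p : A → Bool) {x xs} → x ∈ xs → p x ≡ true → anyB p xs ≡ true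
∃⇒anyB p (here refl) px rewrite px = refl
∃⇒anyB p {xs = y ∷ _} (there x∈) px with p y
... | true = refl
... | false = ∃⇒anyB p x∈ px

containsB⇒subsequence : ∀ π σ → containsB π σ ≡ true →
  ∃[ s ] s ⊆ π × length s ≡ length σ × orderIso s σ ≡ true
containsB⇒subsequence π σ e =
  let s , s∈ , iso = anyB⇒∃ (λ s → orderIso s σ) (subseqs (length σ) π) e
      s⊆π , len = subseqs-sound (length σ) s π s∈
  in s , s⊆π , len , iso

avoids⇒¬ContainsForbidden : ∀ π → avoids2413-3142 π ≡ true → ¬ ContainsForbidden π
avoids⇒¬ContainsForbidden π e (a , b , c , d , occ , inj₁ p)
  rewrite ∃⇒anyB (λ s → orderIso s (2 ∷ 4 ∷ 1 ∷ 3 ∷ [])) (subseqs-complete occ) (orderIso-2413⁺ p) =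
  false≢true e
avoids⇒¬ContainsForbidden π e (a , b , c , d , occ , inj₂ p)
  rewrite ∃⇒anyB (λ s → orderIso s (3 ∷ 1 ∷ 4 ∷ 2 ∷ [])) (subseqs-complete occ) (orderIso-3142⁺ p) =
  false≢true (proj₂ (∧-true⁻ {not (containsB π (2 ∷ 4 ∷ 1 ∷ 3 ∷ []))} e))

¬ContainsForbidden⇒avoids : ∀ π → ¬ ContainsForbidden π → avoids2413-3142 π ≡ true
¬ContainsForbidden⇒avoids π ¬cf with containsB π (2 ∷ 4 ∷ 1 ∷ 3 ∷ []) in e₁
... | true with containsB⇒subsequence π _ e₁
...   | a ∷ b ∷ c ∷ d ∷ [] , occ , _ , iso =
  ⊥-elim (¬cf (a , b , c , d , occ , inj₁ (orderIso-2413⁻ a b c d iso)))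
¬ContainsForbidden⇒avoids π ¬cf | false with containsB π (3 ∷ 1 ∷ 4 ∷ 2 ∷ []) in e₂
... | true with containsB⇒subsequence π _ e₂
...   | a ∷ b ∷ c ∷ d ∷ [] , occ , _ , iso =
  ⊥-elim (¬cf (a , b , c , d , occ , inj₂ (orderIso-3142⁻ a b c d iso)))
¬ContainsForbidden⇒avoids π ¬cf | false | false = refl

_≪_ : List ℕ → List ℕ → Set
A ≪ B = All (λ a → All (a <_) B) A

≪-⊆ : ∀ {A B s₁ s₂} → A ≪ B → s₁ ⊆ A → s₂ ⊆ B → s₁ ≪ s₂
≪-⊆ A≪B s₁⊆A s₂⊆B = All.map (λ p → All-resp-⊆ s₂⊆B p) (All-resp-⊆ s₁⊆A A≪B)

⊆-++⁻ : ∀ xs {ys s} → s ⊆ xs ++ ys →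
        Σ[ s₁ ∈ List ℕ ] Σ[ s₂ ∈ List ℕ ] s ≡ s₁ ++ s₂ × s₁ ⊆ xs × s₂ ⊆ ys
⊆-++⁻ [] p = [] , _ , refl , [] , p
⊆-++⁻ (x ∷ xs) (.x ∷ʳ p) = let s₁ , s₂ , e , q₁ , q₂ = ⊆-++⁻ xs p in s₁ , s₂ , e , x ∷ʳ q₁ , q₂
⊆-++⁻ (x ∷ xs) (refl ∷ p) with ⊆-++⁻ xs p
... | s₁ , s₂ , refl , q₁ , q₂ = x ∷ s₁ , s₂ , refl , refl ∷ q₁ , q₂

shift : ℕ → List ℕ → List ℕ
shift k = map (k +_)

⊆-shift⁻ : ∀ k xs {s} → s ⊆ shift k xs → Σ[ s′ ∈ List ℕ ] s ≡ shift k s′ × s′ ⊆ xs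
⊆-shift⁻ k [] [] = [] , refl , []
⊆-shift⁻ k (x ∷ xs) (_ ∷ʳ p) = let s′ , e , q = ⊆-shift⁻ k xs p in s′ , e , x ∷ʳ q
⊆-shift⁻ k (x ∷ xs) (refl ∷ p) with ⊆-shift⁻ k xs p
... | s′ , refl , q = x ∷ s′ , refl , refl ∷ q

-- A 2413 or 3142 occurrence cannot straddle the boundary of a direct (or skew) sum:
-- each proper prefix of these patterns has an entry above (below) a later entry.
ContainsForbidden-⊕ : ∀ A B → A ≪ B → ContainsForbidden (A ++ B) →
                      ContainsForbidden A ⊎ ContainsForbidden B
ContainsForbidden-⊕ A B A≪B (a , b , c , d , occ , p) =
  let s₁ , s₂ , e , q₁ , q₂ = ⊆-++⁻ A occ in split s₁ s₂ e q₁ q₂ (≪-⊆ A≪B q₁ q₂) p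
  where
  split : ∀ s₁ s₂ → a ∷ b ∷ c ∷ d ∷ [] ≡ s₁ ++ s₂ → s₁ ⊆ A → s₂ ⊆ B → s₁ ≪ s₂ →
          Occ2413 a b c d ⊎ Occ3142 a b c d → ContainsForbidden A ⊎ ContainsForbidden B
  split [] _ refl _ q₂ _ p = inj₂ (a , b , c , d , q₂ , p)
  split (_ ∷ _ ∷ _ ∷ _ ∷ []) [] refl q₁ _ _ p = inj₁ (a , b , c , d , q₁ , p)
  split (_ ∷ []) _ refl _ _ ((_ ∷ a<c ∷ _) ∷ []) (inj₁ (_ , c≤a , _)) = ⊥-elim (<⇒≱ a<c c≤a)
  split (_ ∷ []) _ refl _ _ ((a<b ∷ _) ∷ []) (inj₂ (b≤a , _)) = ⊥-elim (<⇒≱ a<b b≤a)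
  split (_ ∷ _ ∷ []) _ refl _ _ ((a<c ∷ _) ∷ _) (inj₁ (_ , c≤a , _)) = ⊥-elim (<⇒≱ a<c c≤a)
  split (_ ∷ _ ∷ []) _ refl _ _ ((_ ∷ a<d ∷ []) ∷ _) (inj₂ (_ , _ , d≤a , _)) = ⊥-elim (<⇒≱ a<d d≤a)
  split (_ ∷ _ ∷ _ ∷ []) _ refl _ _ (_ ∷ (b<d ∷ []) ∷ _) (inj₁ (_ , _ , _ , _ , d≤b , _)) = ⊥-elim (<⇒≱ b<d d≤b)
  split (_ ∷ _ ∷ _ ∷ []) _ refl _ _ ((a<d ∷ []) ∷ _) (inj₂ (_ , _ , d≤a , _)) = ⊥-elim (<⇒≱ a<d d≤a)

ContainsForbidden-⊖ : ∀ A B → B ≪ A → ContainsForbidden (A ++ B) →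
                      ContainsForbidden A ⊎ ContainsForbidden B
ContainsForbidden-⊖ A B B≪A (a , b , c , d , occ , p) =
  let s₁ , s₂ , e , q₁ , q₂ = ⊆-++⁻ A occ in split s₁ s₂ e q₁ q₂ (≪-⊆ B≪A q₂ q₁) p
  where
  split : ∀ s₁ s₂ → a ∷ b ∷ c ∷ d ∷ [] ≡ s₁ ++ s₂ → s₁ ⊆ A → s₂ ⊆ B → s₂ ≪ s₁ →
          Occ2413 a b c d ⊎ Occ3142 a b c d → ContainsForbidden A ⊎ ContainsForbidden B
  split [] _ refl _ q₂ _ p = inj₂ (a , b , c , d , q₂ , p)
  split (_ ∷ _ ∷ _ ∷ _ ∷ []) [] refl q₁ _ _ p = inj₁ (a , b , c , d , q₁ , p)
  split (_ ∷ []) _ refl _ _ ((b<a ∷ []) ∷ _) (inj₁ (a<b , _)) = ⊥-elim (<⇒≱ b<a (<⇒≤ a<b))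
  split (_ ∷ []) _ refl _ _ (_ ∷ (c<a ∷ []) ∷ _) (inj₂ (_ , a<c , _)) = ⊥-elim (<⇒≱ c<a (<⇒≤ a<c))
  split (_ ∷ _ ∷ []) _ refl _ _ (_ ∷ (d<a ∷ _) ∷ []) (inj₁ (_ , _ , a<d , _)) = ⊥-elim (<⇒≱ d<a (<⇒≤ a<d))
  split (_ ∷ _ ∷ []) _ refl _ _ ((c<a ∷ _) ∷ _) (inj₂ (_ , a<c , _)) = ⊥-elim (<⇒≱ c<a (<⇒≤ a<c))
  split (_ ∷ _ ∷ _ ∷ []) _ refl _ _ ((_ ∷ _ ∷ d<c ∷ []) ∷ []) (inj₁ (_ , _ , _ , _ , _ , c<d)) =
    ⊥-elim (<⇒≱ d<c (<⇒≤ c<d))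
  split (_ ∷ _ ∷ _ ∷ []) _ refl _ _ ((_ ∷ d<b ∷ _) ∷ []) (inj₂ (_ , _ , _ , _ , b<d , _)) = ⊥-elim (<⇒≱ d<b (<⇒≤ b<d))

ContainsForbidden-shift⁻ : ∀ k xs → ContainsForbidden (shift k xs) → ContainsForbidden xs
ContainsForbidden-shift⁻ k xs (_ , _ , _ , _ , occ , p) with ⊆-shift⁻ k xs occ
... | a ∷ b ∷ c ∷ d ∷ [] , refl , q = a , b , c , d , q , unshifted p
  where
  ≤⁻ = +-cancelˡ-≤ k
  <⁻ = +-cancelˡ-< k
  unshifted : Occ2413 (k + a) (k + b) (k + c) (k + d) ⊎ Occ3142 (k + a) (k + b) (k + c) (k + d) →
            Occ2413 a b c d ⊎ Occ3142 a b c d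
  unshifted (inj₁ (p₁ , p₂ , p₃ , p₄ , p₅ , p₆)) =
    inj₁ (<⁻ _ _ p₁ , ≤⁻ _ _ p₂ , <⁻ _ _ p₃ , ≤⁻ _ _ p₄ , ≤⁻ _ _ p₅ , <⁻ _ _ p₆)
  unshifted (inj₂ (p₁ , p₂ , p₃ , p₄ , p₅ , p₆)) =
    inj₂ (≤⁻ _ _ p₁ , <⁻ _ _ p₂ , ≤⁻ _ _ p₃ , <⁻ _ _ p₄ , <⁻ _ _ p₅ , ≤⁻ _ _ p₆)

ContainsForbidden-shift⁺ : ∀ k xs → ContainsForbidden xs → ContainsForbidden (shift k xs)
ContainsForbidden-shift⁺ k xs (a , b , c , d , occ , p) =
  k + a , k + b , k + c , k + d , Sublist.map⁺ (k +_) occ , shifted p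
  where
  shifted : Occ2413 a b c d ⊎ Occ3142 a b c d →
            Occ2413 (k + a) (k + b) (k + c) (k + d) ⊎ Occ3142 (k + a) (k + b) (k + c) (k + d)
  shifted (inj₁ (p₁ , p₂ , p₃ , p₄ , p₅ , p₆)) =
    inj₁ (+-monoʳ-< k p₁ , +-monoʳ-≤ k p₂ , +-monoʳ-< k p₃ , +-monoʳ-≤ k p₄ , +-monoʳ-≤ k p₅ , +-monoʳ-< k p₆)
  shifted (inj₂ (p₁ , p₂ , p₃ , p₄ , p₅ , p₆)) =
    inj₂ (+-monoʳ-≤ k p₁ , +-monoʳ-< k p₂ , +-monoʳ-≤ k p₃ , +-monoʳ-< k p₄ , +-monoʳ-< k p₅ , +-monoʳ-≤ k p₆)

-- The separable permutation of a di-sk tree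

treePerm : BTree → List ℕ
treePerm leaf = 1 ∷ []
treePerm (node ⊕ l r) = treePerm l ++ shift (suc (size l)) (treePerm r)
treePerm (node ⊖ l r) = shift (suc (size r)) (treePerm l) ++ treePerm r

size-node⊕ : ∀ s l r → suc (size l) + suc (size r) ≡ suc (size (node s l r))
size-node⊕ s l r = cong suc (+-suc (size l) (size r))

size-node⊖ : ∀ s l r → suc (size r) + suc (size l) ≡ suc (size (node s l r))
size-node⊖ s l r = trans (+-comm (suc (size r)) (suc (size l))) (size-node⊕ s l r)

length-shift : ∀ k xs → length (shift k xs) ≡ length xs
length-shift k xs = length-map (k +_) xs

length-treePerm : ∀ T → length (treePerm T) ≡ suc (size T)
length-treePerm leaf = refl
length-treePerm (node ⊕ l r) =
  trans (length-++ (treePerm l))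
        (trans (cong₂ _+_ (length-treePerm l) (trans (length-shift _ (treePerm r)) (length-treePerm r)))
               (size-node⊕ ⊕ l r))
length-treePerm (node ⊖ l r) =
  trans (length-++ (shift _ (treePerm l)))
        (trans (cong₂ _+_ (trans (length-shift _ (treePerm l)) (length-treePerm l)) (length-treePerm r))
               (trans (+-comm (suc (size l)) (suc (size r))) (size-node⊖ ⊖ l r)))

InRange-≤ : ∀ {m n x} → m ≤ n → InRange m x → InRange n x
InRange-≤ m≤n (1≤x , x≤m) = 1≤x , ≤-trans x≤m m≤n

InRange-shift : ∀ k {m x} → InRange m x → InRange (k + m) (k + x)
InRange-shift k {m} {x} (1≤x , x≤m) = ≤-trans 1≤x (m≤n+m x k) , +-monoʳ-≤ k x≤m

InRange-≪-shift : ∀ m {k A B} → All (InRange m) A → All (InRange k) B → A ≪ shift m B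
InRange-≪-shift m rA rB = All.map (λ (_ , a≤m) → All.map⁺ (All.map (λ (1≤b , _) → below a≤m 1≤b) rB)) rA
  where
  below : ∀ {a b} → a ≤ m → 1 ≤ b → a < m + b
  below {b = b} a≤m 1≤b = ≤-<-trans a≤m (subst (_≤ m + b) (+-comm m 1) (+-monoʳ-≤ m 1≤b))

treePerm-inRange : ∀ T → All (InRange (suc (size T))) (treePerm T)
treePerm-inRange leaf = (s≤s z≤n , s≤s z≤n) ∷ []
treePerm-inRange (node ⊕ l r) = All.++⁺
  (All.map (InRange-≤ (subst (suc (size l) ≤_) (size-node⊕ ⊕ l r) (m≤m+n _ _))) (treePerm-inRange l))
  (All.map⁺ (All.map (λ {x} p → subst (λ n → InRange n (suc (size l) + x)) (size-node⊕ ⊕ l r)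
                                       (InRange-shift (suc (size l)) p))
                      (treePerm-inRange r)))
treePerm-inRange (node ⊖ l r) = All.++⁺
  (All.map⁺ (All.map (λ {x} p → subst (λ n → InRange n (suc (size r) + x)) (size-node⊖ ⊖ l r)
                                       (InRange-shift (suc (size r)) p))
                      (treePerm-inRange l)))
  (All.map (InRange-≤ (subst (suc (size r) ≤_) (size-node⊖ ⊖ l r) (m≤m+n _ _))) (treePerm-inRange r))

treePerm-≪-⊕ : ∀ l r → treePerm l ≪ shift (suc (size l)) (treePerm r)
treePerm-≪-⊕ l r = InRange-≪-shift (suc (size l)) (treePerm-inRange l) (treePerm-inRange r)

treePerm-≪-⊖ : ∀ l r → treePerm r ≪ shift (suc (size r)) (treePerm l)
treePerm-≪-⊖ l r = InRange-≪-shift (suc (size r)) (treePerm-inRange r) (treePerm-inRange l)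

≪-lookup : ∀ {A B a b} → A ≪ B → a ∈ A → b ∈ B → a < b
≪-lookup A≪B a∈A b∈B = All.lookup (All.lookup A≪B a∈A) b∈B

≪⇒Disjoint : ∀ {A B x} → A ≪ B → ¬ (x ∈ A × x ∈ B)
≪⇒Disjoint A≪B (x∈A , x∈B) = <-irrefl refl (≪-lookup A≪B x∈A x∈B)

Unique-shift : ∀ k {xs} → Unique xs → Unique (shift k xs)
Unique-shift k = Unique.map⁺ (+-cancelˡ-≡ k _ _)

treePerm-unique : ∀ T → Unique (treePerm T)
treePerm-unique leaf = [] ∷ []
treePerm-unique (node ⊕ l r) =
  Unique.++⁺ (treePerm-unique l) (Unique-shift _ (treePerm-unique r)) (≪⇒Disjoint (treePerm-≪-⊕ l r))
treePerm-unique (node ⊖ l r) =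
  Unique.++⁺ (Unique-shift _ (treePerm-unique l)) (treePerm-unique r)
             (λ (x∈L , x∈R) → ≪⇒Disjoint (treePerm-≪-⊖ l r) (x∈R , x∈L))

treePerm-IsPerm : ∀ T → IsPerm (suc (size T)) (treePerm T)
treePerm-IsPerm T = record
  { length-≡ = length-treePerm T ; unique = treePerm-unique T ; inRange = treePerm-inRange T }

treePerm-avoids : ∀ T → ¬ ContainsForbidden (treePerm T)
treePerm-avoids leaf (_ , _ , _ , _ , _ ∷ʳ () , _)
treePerm-avoids leaf (_ , _ , _ , _ , _ ∷ () , _)
treePerm-avoids (node ⊕ l r) cf with ContainsForbidden-⊕ (treePerm l) _ (treePerm-≪-⊕ l r) cf
... | inj₁ cfₗ = treePerm-avoids l cfₗ
... | inj₂ cfᵣ = treePerm-avoids r (ContainsForbidden-shift⁻ _ (treePerm r) cfᵣ)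
treePerm-avoids (node ⊖ l r) cf with ContainsForbidden-⊖ _ (treePerm r) (treePerm-≪-⊖ l r) cf
... | inj₁ cfₗ = treePerm-avoids l (ContainsForbidden-shift⁻ _ (treePerm l) cfₗ)
... | inj₂ cfᵣ = treePerm-avoids r cfᵣ

data NonEmpty : List ℕ → Set where
  nonEmpty : ∀ x xs → NonEmpty (x ∷ xs)

NonEmpty-shift : ∀ k {A} → NonEmpty A → NonEmpty (shift k A)
NonEmpty-shift k (nonEmpty a A) = nonEmpty (k + a) (shift k A)

NonEmpty-++ˡ : ∀ {A} B → NonEmpty A → NonEmpty (A ++ B)
NonEmpty-++ˡ B (nonEmpty a A) = nonEmpty a (A ++ B)

treePerm-nonEmpty : ∀ T → NonEmpty (treePerm T)
treePerm-nonEmpty leaf = nonEmpty 1 []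
treePerm-nonEmpty (node ⊕ l r) = NonEmpty-++ˡ _ (treePerm-nonEmpty l)
treePerm-nonEmpty (node ⊖ l r) = NonEmpty-++ˡ (treePerm r) (NonEmpty-shift _ (treePerm-nonEmpty l))

descentWord : List ℕ → List Label
descentWord (x ∷ y ∷ ys) = (if y <ᵇ x then ⊖ else ⊕) ∷ descentWord (y ∷ ys)
descentWord _ = []

idrAux-descentWord : ∀ x xs → idrAux x xs ≡ initialRun ⊖ (descentWord (x ∷ xs))
idrAux-descentWord x [] = refl
idrAux-descentWord x (y ∷ ys) with y <ᵇ x
... | true = cong suc (idrAux-descentWord y ys)
... | false = refl

idr-descentWord : ∀ {xs} → NonEmpty xs → idr xs ≡ suc (initialRun ⊖ (descentWord xs))
idr-descentWord (nonEmpty x xs) = cong suc (idrAux-descentWord x xs)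

descentWord-++-≪ : ∀ {A B} → NonEmpty A → NonEmpty B → A ≪ B →
                   descentWord (A ++ B) ≡ descentWord A ++ ⊕ ∷ descentWord B
descentWord-++-≪ (nonEmpty a []) (nonEmpty b B) ((a<b ∷ _) ∷ []) rewrite <ᵇ-false (<⇒≤ a<b) = refl
descentWord-++-≪ (nonEmpty a (a′ ∷ A)) neB (_ ∷ A≪B) =
  cong (_ ∷_) (descentWord-++-≪ (nonEmpty a′ A) neB A≪B)

descentWord-++-≫ : ∀ {A B} → NonEmpty A → NonEmpty B → B ≪ A →
                   descentWord (A ++ B) ≡ descentWord A ++ ⊖ ∷ descentWord B
descentWord-++-≫ (nonEmpty a []) (nonEmpty b B) ((b<a ∷ []) ∷ _) rewrite <ᵇ-true b<a = refl
descentWord-++-≫ (nonEmpty a (a′ ∷ A)) neB B≪A =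
  cong (_ ∷_) (descentWord-++-≫ (nonEmpty a′ A) neB (All.map (λ { (_ ∷ p) → p }) B≪A))

<ᵇ-shift : ∀ k a b → ((k + a) <ᵇ (k + b)) ≡ (a <ᵇ b)
<ᵇ-shift zero a b = refl
<ᵇ-shift (suc k) a b = <ᵇ-shift k a b

descentWord-shift : ∀ k xs → descentWord (shift k xs) ≡ descentWord xs
descentWord-shift k [] = refl
descentWord-shift k (x ∷ []) = refl
descentWord-shift k (x ∷ y ∷ ys) =
  cong₂ _∷_ (cong (if_then ⊖ else ⊕) (<ᵇ-shift k y x)) (descentWord-shift k (y ∷ ys))

descentWord-treePerm : ∀ T → descentWord (treePerm T) ≡ inorder T
descentWord-treePerm leaf = refl
descentWord-treePerm (node ⊕ l r) =
  trans (descentWord-++-≪ (treePerm-nonEmpty l) (NonEmpty-shift _ (treePerm-nonEmpty r)) (treePerm-≪-⊕ l r))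
        (cong₂ (λ L R → L ++ ⊕ ∷ R) (descentWord-treePerm l)
               (trans (descentWord-shift _ (treePerm r)) (descentWord-treePerm r)))
descentWord-treePerm (node ⊖ l r) =
  trans (descentWord-++-≫ (NonEmpty-shift _ (treePerm-nonEmpty l)) (treePerm-nonEmpty r) (treePerm-≪-⊖ l r))
        (cong₂ (λ L R → L ++ ⊖ ∷ R) (trans (descentWord-shift _ (treePerm l)) (descentWord-treePerm l))
               (descentWord-treePerm r))

idr-treePerm : ∀ T → idr (treePerm T) ≡ suc (iom T)
idr-treePerm T =
  trans (idr-descentWord (treePerm-nonEmpty T)) (cong (λ w → suc (initialRun ⊖ w)) (descentWord-treePerm T))

≤ᵇ-true : ∀ {a b} → a ≤ b → (a ≤ᵇ b) ≡ true
≤ᵇ-true {zero} _ = refl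
≤ᵇ-true {suc a} a≤b = <ᵇ-true a≤b

≤ᵇ-false : ∀ {a b} → b < a → (a ≤ᵇ b) ≡ false
≤ᵇ-false {suc a} (s≤s b≤a) = <ᵇ-false b≤a

max≡⊔ : ∀ m n → max m n ≡ m ⊔ n
max≡⊔ m n with ≤-<-connex m n
... | inj₁ m≤n rewrite ≤ᵇ-true m≤n = sym (m≤n⇒m⊔n≡n m≤n)
... | inj₂ n<m rewrite ≤ᵇ-false n<m = sym (m≥n⇒m⊔n≡m (<⇒≤ n<m))

max-shift : ∀ k m x → max (k + m) (k + x) ≡ k + max m x
max-shift k m x rewrite max≡⊔ (k + m) (k + x) | max≡⊔ m x = sym (+-distribˡ-⊔ k m x)

≤ᵇ-shift : ∀ k a b → ((k + a) ≤ᵇ (k + b)) ≡ (a ≤ᵇ b)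
≤ᵇ-shift k a b with ≤-<-connex a b
... | inj₁ a≤b rewrite ≤ᵇ-true a≤b | ≤ᵇ-true (+-monoʳ-≤ k a≤b) = refl
... | inj₂ b<a rewrite ≤ᵇ-false b<a | ≤ᵇ-false (+-monoʳ-< k b<a) = refl

runMax : ℕ → List ℕ → ℕ
runMax = foldl max

runMax-shift : ∀ k m xs → runMax (k + m) (shift k xs) ≡ k + runMax m xs
runMax-shift k m [] = refl
runMax-shift k m (x ∷ xs) rewrite max-shift k m x = runMax-shift k (max m x) xs

runMax-bounded : ∀ m {xs} → All (_≤ m) xs → runMax m xs ≡ m
runMax-bounded m [] = refl
runMax-bounded m {x ∷ _} (x≤m ∷ ps) rewrite max≡⊔ m x | m≥n⇒m⊔n≡m x≤m = runMax-bounded m ps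

runMax₀-shift : ∀ k {A} → NonEmpty A → runMax 0 (shift k A) ≡ k + runMax 0 A
runMax₀-shift k (nonEmpty a A) = runMax-shift k a A

treePerm-≤ : ∀ T {m} → suc (size T) ≤ m → All (_≤ m) (treePerm T)
treePerm-≤ T 1+|T|≤m = All.map (λ (_ , x≤) → ≤-trans x≤ 1+|T|≤m) (treePerm-inRange T)

runMax-treePerm : ∀ T → runMax 0 (treePerm T) ≡ suc (size T)
runMax-treePerm leaf = refl
runMax-treePerm (node ⊕ l r)
  rewrite foldl-++ max 0 (treePerm l) (shift (suc (size l)) (treePerm r)) | runMax-treePerm l =
  trans (cong (λ m → runMax m (shift (suc (size l)) (treePerm r))) (sym (+-identityʳ (suc (size l)))))
        (trans (runMax-shift (suc (size l)) 0 (treePerm r))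
               (trans (cong (suc (size l) +_) (runMax-treePerm r)) (size-node⊕ ⊕ l r)))
runMax-treePerm (node ⊖ l r)
  rewrite foldl-++ max 0 (shift (suc (size r)) (treePerm l)) (treePerm r)
        | runMax₀-shift (suc (size r)) (treePerm-nonEmpty l) | runMax-treePerm l =
  trans (runMax-bounded _ (treePerm-≤ r (m≤m+n _ _))) (size-node⊖ ⊖ l r)

compAux-++ : ∀ i m A B → compAux i m (A ++ B) ≡ compAux i m A + compAux (i + length A) (runMax m A) B
compAux-++ i m [] B = cong (λ j → compAux j m B) (sym (+-identityʳ i))
compAux-++ i m (x ∷ A) B rewrite compAux-++ (suc i) (max m x) A B | +-suc i (length A)
  with max m x ≤ᵇ i
... | true = refl
... | false = refl

compAux-shift : ∀ k i m xs → compAux (k + i) (k + m) (shift k xs) ≡ compAux i m xs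
compAux-shift k i m [] = refl
compAux-shift k i m (x ∷ xs) rewrite max-shift k m x | ≤ᵇ-shift k (max m x) i | sym (+-suc k i)
  with max m x ≤ᵇ i
... | true = cong suc (compAux-shift k (suc i) (max m x) xs)
... | false = compAux-shift k (suc i) (max m x) xs

MaxAtLeastPos : ℕ → ℕ → List ℕ → Set
MaxAtLeastPos i m [] = ⊤
MaxAtLeastPos i m (x ∷ xs) = i ≤ max m x × MaxAtLeastPos (suc i) (max m x) xs

MaxAtLeastPos-++ : ∀ i m A {B} → MaxAtLeastPos i m A →
                   MaxAtLeastPos (i + length A) (runMax m A) B → MaxAtLeastPos i m (A ++ B)
MaxAtLeastPos-++ i m [] _ q = subst (λ j → MaxAtLeastPos j m _) (+-identityʳ i) q
MaxAtLeastPos-++ i m (x ∷ A) {B} (p , qA) qB =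
  p , MaxAtLeastPos-++ (suc i) (max m x) A qA
        (subst (λ j → MaxAtLeastPos j (runMax (max m x) A) B) (+-suc i (length A)) qB)

MaxAtLeastPos-shift : ∀ k i m xs → MaxAtLeastPos i m xs → MaxAtLeastPos (k + i) (k + m) (shift k xs)
MaxAtLeastPos-shift k i m [] _ = tt
MaxAtLeastPos-shift k i m (x ∷ xs) (p , q) rewrite max-shift k m x =
  +-monoʳ-≤ k p ,
  subst (λ j → MaxAtLeastPos j (k + max m x) (shift k xs)) (+-suc k i) (MaxAtLeastPos-shift k (suc i) (max m x) xs q)

MaxAtLeastPos-≤ : ∀ {j i} m xs → j ≤ i → MaxAtLeastPos i m xs → MaxAtLeastPos j m xs
MaxAtLeastPos-≤ m [] _ _ = tt
MaxAtLeastPos-≤ m (x ∷ xs) j≤i (p , q) = ≤-trans j≤i p , MaxAtLeastPos-≤ (max m x) xs (s≤s j≤i) q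

MaxAtLeastPos-shift₀ : ∀ k {A} → NonEmpty A → MaxAtLeastPos 1 0 A → MaxAtLeastPos 1 0 (shift k A)
MaxAtLeastPos-shift₀ k (nonEmpty a A) (1≤a , q) =
  ≤-trans 1≤a (m≤n+m a k) , MaxAtLeastPos-≤ (k + a) (shift k A) (m≤n+m 2 k) (MaxAtLeastPos-shift k 2 a A q)

MaxAtLeastPos-bounded : ∀ i M {B} → All (_≤ M) B → i + length B ≤ suc M → MaxAtLeastPos i M B
MaxAtLeastPos-bounded i M [] _ = tt
MaxAtLeastPos-bounded i M {x ∷ B} (x≤M ∷ ps) len rewrite max≡⊔ M x | m≥n⇒m⊔n≡m x≤M =
  ≤-trans (m≤m+n i (length B)) (≤-pred len′) , MaxAtLeastPos-bounded (suc i) M ps len′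
  where len′ = subst (_≤ suc M) (+-suc i (length B)) len

MaxAtLeastPos-treePerm : ∀ T → MaxAtLeastPos 1 0 (treePerm T)
MaxAtLeastPos-treePerm leaf = s≤s z≤n , tt
MaxAtLeastPos-treePerm (node ⊕ l r) =
  MaxAtLeastPos-++ 1 0 (treePerm l) (MaxAtLeastPos-treePerm l) right
  where
  k = suc (size l)
  right : MaxAtLeastPos (1 + length (treePerm l)) (runMax 0 (treePerm l)) (shift k (treePerm r))
  right rewrite length-treePerm l | runMax-treePerm l =
    subst₂ (λ i m → MaxAtLeastPos i m (shift k (treePerm r))) (+-comm k 1) (+-identityʳ k)
           (MaxAtLeastPos-shift k 1 0 (treePerm r) (MaxAtLeastPos-treePerm r))
MaxAtLeastPos-treePerm (node ⊖ l r) =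
  MaxAtLeastPos-++ 1 0 (shift k (treePerm l))
    (MaxAtLeastPos-shift₀ k (treePerm-nonEmpty l) (MaxAtLeastPos-treePerm l)) right
  where
  k = suc (size r)
  right : MaxAtLeastPos (1 + length (shift k (treePerm l))) (runMax 0 (shift k (treePerm l))) (treePerm r)
  right rewrite runMax₀-shift k (treePerm-nonEmpty l) | runMax-treePerm l
              | length-shift k (treePerm l) | length-treePerm l =
    MaxAtLeastPos-bounded _ _ (treePerm-≤ r (m≤m+n _ _))
      (≤-reflexive (cong suc (trans (cong (suc (size l) +_) (length-treePerm r)) (+-comm (suc (size l)) k))))

compAux-shift-zero : ∀ k i m xs → 1 ≤ k → MaxAtLeastPos i m xs → compAux i (k + m) (shift k xs) ≡ 0
compAux-shift-zero k i m [] _ _ = refl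
compAux-shift-zero k i m (x ∷ xs) 1≤k (i≤ , q)
  rewrite max-shift k m x | ≤ᵇ-false {k + max m x} {i} (≤-trans (s≤s i≤) (+-monoˡ-≤ (max m x) 1≤k)) =
  compAux-shift-zero k (suc i) (max m x) xs 1≤k q

compAux-shift₀-zero : ∀ k {A} → 1 ≤ k → NonEmpty A → MaxAtLeastPos 1 0 A → compAux 1 0 (shift k A) ≡ 0
compAux-shift₀-zero k 1≤k (nonEmpty a A) (1≤a , q)
  rewrite ≤ᵇ-false {k + a} {1} (+-mono-≤ 1≤k 1≤a) = compAux-shift-zero k 2 a A 1≤k q

compAux-bounded : ∀ i M {B} → All (_≤ M) B → i + length B ≡ suc M → NonEmpty B → compAux i M B ≡ 1
compAux-bounded i M (x≤M ∷ []) len (nonEmpty x [])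
  rewrite max≡⊔ M x | m≥n⇒m⊔n≡m x≤M | ≤ᵇ-true {M} {i} (≤-reflexive (suc-injective (trans (sym len) (+-comm i 1)))) =
  refl
compAux-bounded i M {x ∷ y ∷ B} (x≤M ∷ ps) len (nonEmpty x _)
  rewrite max≡⊔ M x | m≥n⇒m⊔n≡m x≤M
        | ≤ᵇ-false {M} {i} (subst (i <_) (suc-injective (trans (sym (+-suc i (suc (length B)))) len))
                                  (m<m+n i (s≤s z≤n))) =
  compAux-bounded (suc i) M ps len′ (nonEmpty y B)
  where len′ = trans (sym (+-suc i (suc (length B)))) len

top-rightOK⊕ : ∀ r → rightOK ⊕ r ≡ true → top r ≡ 0
top-rightOK⊕ leaf _ = refl
top-rightOK⊕ (node ⊖ _ _) _ = refl

comp-treePerm : ∀ T → isDiSk T ≡ true → comp (treePerm T) ≡ suc (top T)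
comp-treePerm leaf _ = refl
comp-treePerm (node ⊕ l r) d
  rewrite compAux-++ 1 0 (treePerm l) (shift (suc (size l)) (treePerm r))
        | length-treePerm l | runMax-treePerm l | comp-treePerm l (leftDiSk ⊕ l r d)
        | top-node⊕ l r (rootOK ⊕ l r d) =
  trans (cong (suc (top l) +_) right) (+-comm (suc (top l)) 1)
  where
  k = suc (size l)
  right : compAux (suc k) k (shift k (treePerm r)) ≡ 1
  right = begin
    compAux (suc k) k (shift k (treePerm r))
      ≡⟨ cong₂ (λ i m → compAux i m (shift k (treePerm r))) (+-comm 1 k) (sym (+-identityʳ k)) ⟩
    compAux (k + 1) (k + 0) (shift k (treePerm r)) ≡⟨ compAux-shift k 1 0 (treePerm r) ⟩
    comp (treePerm r)                              ≡⟨ comp-treePerm r (rightDiSk ⊕ l r d) ⟩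
    suc (top r)                                    ≡⟨ cong suc (top-rightOK⊕ r (rootOK ⊕ l r d)) ⟩
    1                                              ∎
    where open ≡-Reasoning
comp-treePerm (node ⊖ l r) d
  rewrite compAux-++ 1 0 (shift (suc (size r)) (treePerm l)) (treePerm r) =
  cong₂ _+_ (compAux-shift₀-zero k (s≤s z≤n) (treePerm-nonEmpty l) (MaxAtLeastPos-treePerm l))
            (compAux-bounded _ _ bounded len (treePerm-nonEmpty r))
  where
  k = suc (size r)
  bounded : All (_≤ runMax 0 (shift k (treePerm l))) (treePerm r)
  bounded rewrite runMax₀-shift k (treePerm-nonEmpty l) | runMax-treePerm l = treePerm-≤ r (m≤m+n _ _)
  len : 1 + length (shift k (treePerm l)) + length (treePerm r) ≡ suc (runMax 0 (shift k (treePerm l)))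
  len rewrite runMax₀-shift k (treePerm-nonEmpty l) | runMax-treePerm l
            | length-shift k (treePerm l) | length-treePerm l | length-treePerm r =
    cong suc (+-comm (suc (size l)) k)

-- Injectivity of treePerm

DirectSplit SkewSplit : List ℕ → Set
DirectSplit π = Σ[ A ∈ List ℕ ] Σ[ B ∈ List ℕ ] NonEmpty A × NonEmpty B × π ≡ A ++ B × A ≪ B
SkewSplit π = Σ[ A ∈ List ℕ ] Σ[ B ∈ List ℕ ] NonEmpty A × NonEmpty B × π ≡ A ++ B × B ≪ A

++-≡-++ : ∀ (A B A′ B′ : List ℕ) → A ++ B ≡ A′ ++ B′ →
  (Σ[ C ∈ List ℕ ] A′ ≡ A ++ C × B ≡ C ++ B′) ⊎ (Σ[ C ∈ List ℕ ] A ≡ A′ ++ C × B′ ≡ C ++ B)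
++-≡-++ [] B A′ B′ e = inj₁ (A′ , refl , e)
++-≡-++ (a ∷ A) B [] B′ e = inj₂ (a ∷ A , refl , sym e)
++-≡-++ (a ∷ A) B (a′ ∷ A′) B′ e with ∷-injective e
... | refl , e′ with ++-≡-++ A B A′ B′ e′
...   | inj₁ (C , p , q) = inj₁ (C , cong (a ∷_) p , q)
...   | inj₂ (C , p , q) = inj₂ (C , cong (a ∷_) p , q)

++-≡-++-unique : ∀ A B A′ B′ → A ++ B ≡ A′ ++ B′ →
  (∀ C → NonEmpty C → A′ ≡ A ++ C → B ≡ C ++ B′ → ⊥) →
  (∀ C → NonEmpty C → A ≡ A′ ++ C → B′ ≡ C ++ B → ⊥) →
  A ≡ A′ × B ≡ B′
++-≡-++-unique A B A′ B′ e no₁ no₂ with ++-≡-++ A B A′ B′ e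
... | inj₁ ([] , p , q) = sym (trans p (++-identityʳ A)) , q
... | inj₁ (c ∷ C , p , q) = ⊥-elim (no₁ (c ∷ C) (nonEmpty c C) p q)
... | inj₂ ([] , p , q) = trans p (++-identityʳ A′) , sym q
... | inj₂ (c ∷ C , p , q) = ⊥-elim (no₂ (c ∷ C) (nonEmpty c C) p q)

¬DirectSplit×SkewSplit : ∀ {π} → DirectSplit π → SkewSplit π → ⊥
¬DirectSplit×SkewSplit (A , B , nonEmpty a A₀ , neB , refl , A≪B)
                       (A′ , B′ , nonEmpty a′ A₀′ , neB′ , e , B′≪A′)
  with ++-≡-++ (a ∷ A₀) B (a′ ∷ A₀′) B′ e | neB | neB′
... | inj₁ (C , p , q) | _ | nonEmpty w _ =
  <-irrefl refl (<-trans (≪-lookup A≪B (here refl) (subst (w ∈_) (sym q) (∈-++⁺ʳ C (here refl))))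
                         (≪-lookup B′≪A′ (here refl) (subst (a ∈_) (sym p) (here refl))))
... | inj₂ (C , p , q) | nonEmpty w _ | _ =
  <-irrefl refl (<-trans (≪-lookup A≪B (here refl) (here refl))
                         (≪-lookup B′≪A′ (subst (w ∈_) (sym q) (∈-++⁺ʳ C (here refl))) (here (proj₁ (∷-injective p)))))

length-split : ∀ {π A B} → NonEmpty A → NonEmpty B → π ≡ A ++ B → 2 ≤ length π
length-split {B = b ∷ B} (nonEmpty a A) (nonEmpty b B) refl rewrite length-++ A {b ∷ B} =
  s≤s (subst (1 ≤_) (sym (+-suc (length A) (length B))) (s≤s z≤n))

≪-shift : ∀ k {A B} → A ≪ B → shift k A ≪ shift k B
≪-shift k A≪B = All.map⁺ (All.map (λ a≪B → All.map⁺ (All.map (+-monoʳ-< k) a≪B)) A≪B)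

SkewSplit-shift : ∀ k {π} → SkewSplit π → SkewSplit (shift k π)
SkewSplit-shift k (A , B , neA , neB , refl , B≪A) =
  shift k A , shift k B , NonEmpty-shift k neA , NonEmpty-shift k neB , map-++ (k +_) A B , ≪-shift k B≪A

DirectSplit-treePerm : ∀ l r → DirectSplit (treePerm (node ⊕ l r))
DirectSplit-treePerm l r =
  treePerm l , _ , treePerm-nonEmpty l , NonEmpty-shift _ (treePerm-nonEmpty r) , refl , treePerm-≪-⊕ l r

SkewSplit-treePerm : ∀ l r → SkewSplit (treePerm (node ⊖ l r))
SkewSplit-treePerm l r =
  _ , treePerm r , NonEmpty-shift _ (treePerm-nonEmpty l) , treePerm-nonEmpty r , refl , treePerm-≪-⊖ l r

¬DirectSplit-treePerm : ∀ r → rightOK ⊕ r ≡ true → ∀ k → ¬ DirectSplit (shift k (treePerm r))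
¬DirectSplit-treePerm leaf _ k (_ , _ , neA , neB , e , _) with length-split neA neB e
... | s≤s ()
¬DirectSplit-treePerm (node ⊖ a b) _ k split =
  ¬DirectSplit×SkewSplit split (SkewSplit-shift k (SkewSplit-treePerm a b))

¬SkewSplit-treePerm : ∀ r → rightOK ⊖ r ≡ true → ¬ SkewSplit (treePerm r)
¬SkewSplit-treePerm leaf _ (_ , _ , neA , neB , e , _) with length-split neA neB e
... | s≤s ()
¬SkewSplit-treePerm (node ⊕ a b) _ split = ¬DirectSplit×SkewSplit (DirectSplit-treePerm a b) split

shift-injective : ∀ k {xs ys} → shift k xs ≡ shift k ys → xs ≡ ys
shift-injective k = map-injective (+-cancelˡ-≡ k _ _)

-- If the cut of a direct (skew) sum could move right by a nonempty C, then the right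
-- summand would itself split as C followed by the rest, which its root label forbids.
⊕-cut-rigid : ∀ l r l′ r′ → isDiSk (node ⊕ l r) ≡ true → ∀ C → NonEmpty C →
  treePerm l′ ≡ treePerm l ++ C →
  shift (suc (size l)) (treePerm r) ≡ C ++ shift (suc (size l′)) (treePerm r′) → ⊥
⊕-cut-rigid l r l′ r′ d C neC p q =
  ¬DirectSplit-treePerm r (rootOK ⊕ l r d) _
    (C , _ , neC , NonEmpty-shift _ (treePerm-nonEmpty r′) , q ,
     All.++⁻ʳ (treePerm l) (subst (_≪ _) p (treePerm-≪-⊕ l′ r′)))

⊖-cut-rigid : ∀ l r l′ r′ → isDiSk (node ⊖ l r) ≡ true → ∀ C → NonEmpty C →
  shift (suc (size r′)) (treePerm l′) ≡ shift (suc (size r)) (treePerm l) ++ C →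
  treePerm r ≡ C ++ treePerm r′ → ⊥
⊖-cut-rigid l r l′ r′ d C neC p q =
  ¬SkewSplit-treePerm r (rootOK ⊖ l r d)
    (C , treePerm r′ , neC , treePerm-nonEmpty r′ , q ,
     All.map (All.++⁻ʳ (shift (suc (size r)) (treePerm l))) (subst (treePerm r′ ≪_) p (treePerm-≪-⊖ l′ r′)))

treePerm-injective : ∀ T T′ → isDiSk T ≡ true → isDiSk T′ ≡ true → treePerm T ≡ treePerm T′ → T ≡ T′
treePerm-injective leaf leaf _ _ _ = refl
treePerm-injective leaf (node s l r) _ _ e with trans (cong length e) (length-treePerm (node s l r))
... | ()
treePerm-injective (node s l r) leaf _ _ e with trans (sym (length-treePerm (node s l r))) (cong length e)
... | ()
treePerm-injective (node ⊕ l r) (node ⊖ l′ r′) _ _ e =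
  ⊥-elim (¬DirectSplit×SkewSplit (subst DirectSplit e (DirectSplit-treePerm l r)) (SkewSplit-treePerm l′ r′))
treePerm-injective (node ⊖ l r) (node ⊕ l′ r′) _ _ e =
  ⊥-elim (¬DirectSplit×SkewSplit (DirectSplit-treePerm l′ r′) (subst SkewSplit e (SkewSplit-treePerm l r)))
treePerm-injective (node ⊕ l r) (node ⊕ l′ r′) d d′ e
  with ++-≡-++-unique (treePerm l) _ (treePerm l′) _ e (⊕-cut-rigid l r l′ r′ d) (⊕-cut-rigid l′ r′ l r d′)
... | eₗ , eᵣ with treePerm-injective l l′ (leftDiSk ⊕ l r d) (leftDiSk ⊕ l′ r′ d′) eₗ
...   | refl =
  cong (node ⊕ l) (treePerm-injective r r′ (rightDiSk ⊕ l r d) (rightDiSk ⊕ l r′ d′) (shift-injective _ eᵣ))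
treePerm-injective (node ⊖ l r) (node ⊖ l′ r′) d d′ e
  with ++-≡-++-unique _ (treePerm r) _ (treePerm r′) e (⊖-cut-rigid l r l′ r′ d) (⊖-cut-rigid l′ r′ l r d′)
... | eₗ , eᵣ with treePerm-injective r r′ (rightDiSk ⊖ l r d) (rightDiSk ⊖ l′ r′ d′) eᵣ
...   | refl =
  cong (λ L → node ⊖ L r) (treePerm-injective l l′ (leftDiSk ⊖ l r d) (leftDiSk ⊖ l′ r d′) (shift-injective _ eₗ))

-- Separable permutations are direct or skew sums

twoBlocks⊎inversion : ∀ {P Q : ℕ → Set} zs → All (λ z → P z ⊎ Q z) zs →
  (Σ[ Lo ∈ List ℕ ] Σ[ Hi ∈ List ℕ ] zs ≡ Lo ++ Hi × All P Lo × All Q Hi) ⊎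
  (Σ[ x ∈ ℕ ] Σ[ w ∈ ℕ ] (x ∷ w ∷ []) ⊆ zs × Q x × P w)
twoBlocks⊎inversion [] [] = inj₁ ([] , [] , refl , [] , [])
twoBlocks⊎inversion (z ∷ zs) (pq ∷ pqs) with twoBlocks⊎inversion zs pqs | pq
... | inj₂ (x , w , xw⊆zs , qx , pw) | _ = inj₂ (x , w , z ∷ʳ xw⊆zs , qx , pw)
... | inj₁ (Lo , Hi , refl , pLo , qHi) | inj₁ pz = inj₁ (z ∷ Lo , Hi , refl , pz ∷ pLo , qHi)
... | inj₁ ([] , Hi , refl , [] , qHi) | inj₂ qz = inj₁ ([] , z ∷ Hi , refl , [] , qz ∷ qHi)
... | inj₁ (w ∷ Lo , Hi , refl , pw ∷ _ , _) | inj₂ qz =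
  inj₂ (z , w , refl ∷ refl ∷ []⊆-universal _ , qz , pw)

≢⇒<⊎> : ∀ {v z} → v ≢ z → z < v ⊎ v < z
≢⇒<⊎> {v} {z} v≢z with <-cmp z v
... | tri< z<v _ _ = inj₁ z<v
... | tri≈ _ z≡v _ = ⊥-elim (v≢z (sym z≡v))
... | tri> _ _ v<z = inj₂ v<z

≮∧≢⇒> : ∀ {v z} → ¬ v < z → v ≢ z → z < v
≮∧≢⇒> v≮z v≢z = ≤∧≢⇒< (≮⇒≥ v≮z) (λ z≡v → v≢z (sym z≡v))

findAbove : ∀ v zs → ¬ All (_< v) zs → All (v ≢_) zs → Σ[ d ∈ ℕ ] d ∈ zs × v < d
findAbove v zs ¬below v≢ =
  let d , d∈ , d≮v = find (All.¬All⇒Any¬ (_<? v) zs ¬below) in d , d∈ , ≮∧≢⇒> d≮v (λ e → All.lookup v≢ d∈ (sym e))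

findBelow : ∀ v zs → ¬ All (v <_) zs → All (v ≢_) zs → Σ[ c ∈ ℕ ] c ∈ zs × c < v
findBelow v zs ¬above v≢ =
  let c , c∈ , v≮c = find (All.¬All⇒Any¬ (v <?_) zs ¬above) in c , c∈ , ≮∧≢⇒> v≮c (All.lookup v≢ c∈)

∈⇒NonEmpty : ∀ {x xs} → x ∈ xs → NonEmpty xs
∈⇒NonEmpty {xs = y ∷ ys} _ = nonEmpty y ys

Split : List ℕ → Set
Split π = DirectSplit π ⊎ SkewSplit π

cut-direct : ∀ v a ys′ {zs c d} → (a ∷ ys′) ≪ zs → All (v ≢_) zs →
  ¬ ContainsForbidden (v ∷ (a ∷ ys′) ++ zs) → c ∈ zs → c < v → d ∈ zs → v < d → Split (v ∷ (a ∷ ys′) ++ zs)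
cut-direct v a ys′ {zs} ys≪zs v≢ ¬cf c∈zs c<v d∈zs v<d with twoBlocks⊎inversion zs (All.map ≢⇒<⊎> v≢)
... | inj₁ (Lo , Hi , refl , Lo<v , v<Hi) =
  inj₁ (v ∷ ys ++ Lo , Hi , nonEmpty v (ys ++ Lo) , neHi , cong (v ∷_) (sym (++-assoc ys Lo Hi)) ,
        v<Hi ∷ All.++⁺ (All.map (All.++⁻ʳ Lo) ys≪zs) (All.map (λ l<v → All.map (<-trans l<v) v<Hi) Lo<v))
  where
  ys = a ∷ ys′
  neHi : NonEmpty Hi
  neHi with ∈-++⁻ Lo d∈zs
  ... | inj₁ d∈Lo = ⊥-elim (<-irrefl refl (<-trans v<d (All.lookup Lo<v d∈Lo)))
  ... | inj₂ d∈Hi = ∈⇒NonEmpty d∈Hi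
... | inj₂ (x , w , xw⊆zs , v<x , w<v) with All-resp-⊆ xw⊆zs (All.lookup ys≪zs (here refl))
...   | a<x ∷ a<w ∷ [] = ⊥-elim (¬cf (v , a , x , w , refl ∷ refl ∷ ++⁺ˡ ys′ xw⊆zs ,
        inj₂ (<⇒≤ a<v , v<x , <⇒≤ w<v , a<x , a<w , <⇒≤ (<-trans w<v v<x))))
  where a<v = <-trans (≪-lookup ys≪zs (here refl) c∈zs) c<v

cut-skew : ∀ v a ys′ {zs c d} → zs ≪ (a ∷ ys′) → All (v ≢_) zs →
  ¬ ContainsForbidden (v ∷ (a ∷ ys′) ++ zs) → v < c → c ∈ zs → d ∈ zs → d < v → Split (v ∷ (a ∷ ys′) ++ zs)
cut-skew v a ys′ {zs} zs≪ys v≢ ¬cf v<c c∈zs d∈zs d<v with twoBlocks⊎inversion zs (All.map (λ v≢z → swap (≢⇒<⊎> v≢z)) v≢)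
... | inj₁ (Hi , Lo , refl , v<Hi , Lo<v) =
  inj₂ (v ∷ ys ++ Hi , Lo , nonEmpty v (ys ++ Hi) , neLo , cong (v ∷_) (sym (++-assoc ys Hi Lo)) ,
        All.zipWith (λ (l<v , l<ys) → l<v ∷ All.++⁺ l<ys (All.map (<-trans l<v) v<Hi)) (Lo<v , All.++⁻ʳ Hi zs≪ys))
  where
  ys = a ∷ ys′
  neLo : NonEmpty Lo
  neLo with ∈-++⁻ Hi d∈zs
  ... | inj₁ d∈Hi = ⊥-elim (<-irrefl refl (<-trans d<v (All.lookup v<Hi d∈Hi)))
  ... | inj₂ d∈Lo = ∈⇒NonEmpty d∈Lo
... | inj₂ (x , w , xw⊆zs , x<v , v<w) with All-resp-⊆ xw⊆zs zs≪ys
...   | (x<a ∷ _) ∷ (w<a ∷ _) ∷ [] = ⊥-elim (¬cf (v , a , x , w , refl ∷ refl ∷ ++⁺ˡ ys′ xw⊆zs ,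
        inj₁ (v<a , <⇒≤ x<v , v<w , <⇒≤ x<a , <⇒≤ w<a , <-trans x<v v<w)))
  where v<a = <-trans v<c (≪-lookup zs≪ys c∈zs (here refl))

-- Prepending v to a direct sum ys ⊕ zs: v extends ys, or stands alone as a skew summand, or
-- cuts zs into a low and a high block; any other position of v creates a 3142.
cons-direct : ∀ v {ys zs} → NonEmpty ys → NonEmpty zs → ys ≪ zs → All (v ≢_) (ys ++ zs) →
              ¬ ContainsForbidden (v ∷ ys ++ zs) → Split (v ∷ ys ++ zs)
cons-direct v {ys} {zs} (nonEmpty a ys′) neZs ys≪zs v≢ ¬cf with all? (v <?_) zs | all? (_<? v) (ys ++ zs)
... | yes v<zs | _ = inj₁ (v ∷ ys , zs , nonEmpty v ys , neZs , refl , v<zs ∷ ys≪zs)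
... | no _ | yes below =
  inj₂ (v ∷ [] , ys ++ zs , nonEmpty v [] , nonEmpty a (ys′ ++ zs) , refl , All.map (_∷ []) below)
... | no ¬above | no ¬below with findBelow v zs ¬above (All.++⁻ʳ ys v≢) | findAbove v (ys ++ zs) ¬below v≢
...   | c , c∈zs , c<v | d , d∈ , v<d with ∈-++⁻ ys d∈
...     | inj₁ d∈ys = ⊥-elim (<-irrefl refl (<-trans (≪-lookup ys≪zs d∈ys c∈zs) (<-trans c<v v<d)))
...     | inj₂ d∈zs = cut-direct v a ys′ ys≪zs (All.++⁻ʳ ys v≢) ¬cf c∈zs c<v d∈zs v<d

cons-skew : ∀ v {ys zs} → NonEmpty ys → NonEmpty zs → zs ≪ ys → All (v ≢_) (ys ++ zs) →
            ¬ ContainsForbidden (v ∷ ys ++ zs) → Split (v ∷ ys ++ zs)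
cons-skew v {ys} {zs} (nonEmpty a ys′) neZs zs≪ys v≢ ¬cf with all? (_<? v) zs | all? (v <?_) (ys ++ zs)
... | yes zs<v | _ =
  inj₂ (v ∷ ys , zs , nonEmpty v ys , neZs , refl , All.zipWith (λ (z<v , z<ys) → z<v ∷ z<ys) (zs<v , zs≪ys))
... | no _ | yes above = inj₁ (v ∷ [] , ys ++ zs , nonEmpty v [] , nonEmpty a (ys′ ++ zs) , refl , above ∷ [])
... | no ¬below | no ¬above with findAbove v zs ¬below (All.++⁻ʳ ys v≢) | findBelow v (ys ++ zs) ¬above v≢
...   | c , c∈zs , v<c | d , d∈ , d<v with ∈-++⁻ ys d∈
...     | inj₁ d∈ys = ⊥-elim (<-irrefl refl (<-trans (≪-lookup zs≪ys c∈zs d∈ys) (<-trans d<v v<c)))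
...     | inj₂ d∈zs = cut-skew v a ys′ zs≪ys (All.++⁻ʳ ys v≢) ¬cf v<c c∈zs d∈zs d<v

separable-split : ∀ π → Unique π → ¬ ContainsForbidden π → 2 ≤ length π → Split π
separable-split (_ ∷ []) _ _ (s≤s ())
separable-split (x ∷ y ∷ []) ((x≢y ∷ []) ∷ _) _ _ with ≢⇒<⊎> x≢y
... | inj₁ y<x = inj₂ (x ∷ [] , y ∷ [] , nonEmpty x [] , nonEmpty y [] , refl , (y<x ∷ []) ∷ [])
... | inj₂ x<y = inj₁ (x ∷ [] , y ∷ [] , nonEmpty x [] , nonEmpty y [] , refl , (x<y ∷ []) ∷ [])
separable-split (v ∷ π@(_ ∷ _ ∷ _)) (v≢ ∷ uπ) ¬cf _
  with separable-split π uπ (λ cf → ¬cf (ContainsForbidden-⊆ (v ∷ʳ ⊆-refl) cf)) (s≤s (s≤s z≤n))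
... | inj₁ (ys , zs , neYs , neZs , e , ys≪zs) =
  subst Split (cong (v ∷_) (sym e)) (cons-direct v neYs neZs ys≪zs (subst (All (v ≢_)) e v≢) (¬cf ∘ subst ContainsForbidden (cong (v ∷_) (sym e))))
... | inj₂ (ys , zs , neYs , neZs , e , zs≪ys) =
  subst Split (cong (v ∷_) (sym e)) (cons-skew v neYs neZs zs≪ys (subst (All (v ≢_)) e v≢) (¬cf ∘ subst ContainsForbidden (cong (v ∷_) (sym e))))

remove : ℕ → List ℕ → List ℕ
remove h [] = []
remove h (x ∷ xs) with x ≟ h
... | yes _ = xs
... | no _ = x ∷ remove h xs

remove-⊆ : ∀ h xs → remove h xs ⊆ xs
remove-⊆ h [] = []
remove-⊆ h (x ∷ xs) with x ≟ h
... | yes _ = x ∷ʳ ⊆-refl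
... | no _ = refl ∷ remove-⊆ h xs

length-remove : ∀ {h xs} → h ∈ xs → length xs ≡ suc (length (remove h xs))
length-remove {h} {x ∷ xs} h∈ with x ≟ h | h∈
... | yes _ | _ = refl
... | no x≢h | here refl = ⊥-elim (x≢h refl)
... | no _ | there h∈xs = cong suc (length-remove h∈xs)

Unique-remove : ∀ h {xs} → Unique xs → Unique (remove h xs)
Unique-remove h [] = []
Unique-remove h {x ∷ xs} (x≢xs ∷ u) with x ≟ h
... | yes _ = u
... | no _ = All-resp-⊆ (remove-⊆ h xs) x≢xs ∷ Unique-remove h u

∈-remove⁻ : ∀ h {xs y} → Unique xs → y ∈ remove h xs → y ≢ h
∈-remove⁻ h {x ∷ xs} (x≢xs ∷ u) y∈ with x ≟ h
∈-remove⁻ h {x ∷ xs} (x≢xs ∷ u) y∈ | yes refl = λ { refl → All.lookup x≢xs y∈ refl }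
∈-remove⁻ h {x ∷ xs} (x≢xs ∷ u) (here refl) | no x≢h = x≢h
∈-remove⁻ h {x ∷ xs} (x≢xs ∷ u) (there y∈) | no _ = ∈-remove⁻ h u y∈

Between : ℕ → ℕ → ℕ → Set
Between lo hi x = lo < x × x ≤ hi

length-Between : ∀ lo hi {xs} → Unique xs → All (Between lo hi) xs → length xs ≤ hi ∸ lo
length-Between lo zero [] [] = z≤n
length-Between lo zero {x ∷ _} _ ((lo<x , x≤0) ∷ _) with ≤-trans lo<x x≤0
... | ()
length-Between lo (suc h) {xs} u between with suc h ∈? xs
... | no h∉ = ≤-trans (length-Between lo h u (All.tabulate below)) (∸-monoˡ-≤ lo (n≤1+n h))
  where
  below : ∀ {x} → x ∈ xs → Between lo h x
  below x∈ = let lo<x , x≤ = All.lookup between x∈ in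
             lo<x , ≤-pred (≤∧≢⇒< x≤ (λ { refl → h∉ x∈ }))
... | yes h∈ = subst (_≤ suc h ∸ lo) (sym (length-remove h∈))
  (subst (suc (length (remove (suc h) xs)) ≤_) (sym (+-∸-assoc 1 (≤-pred (proj₁ (All.lookup between h∈)))))
         (s≤s (length-Between lo h (Unique-remove (suc h) u) (All.tabulate below))))
  where
  below : ∀ {x} → x ∈ remove (suc h) xs → Between lo h x
  below x∈ = let lo<x , x≤ = All.lookup between (Any-resp-⊆ (remove-⊆ (suc h) xs) x∈) in
             lo<x , ≤-pred (≤∧≢⇒< x≤ (∈-remove⁻ (suc h) u x∈))

Unique-++⁻ : ∀ (xs : List ℕ) {ys} → Unique (xs ++ ys) → Unique xs × Unique ys
Unique-++⁻ [] u = [] , u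
Unique-++⁻ (x ∷ xs) (x≢ ∷ u) = (All.++⁻ˡ xs x≢ ∷ proj₁ (Unique-++⁻ xs u)) , proj₂ (Unique-++⁻ xs u)

lower-block : ∀ n {A B} → Unique B → All (_≤ n) A → All (_≤ n) B → length A + length B ≡ n → A ≪ B →
              All (_≤ length A) A
lower-block n {A} {B} uB A≤n B≤n len A≪B = All.tabulate bound
  where
  bound : ∀ {x} → x ∈ A → x ≤ length A
  bound {x} x∈A = +-cancelˡ-≤ (length B) x (length A) (begin
    length B + x          ≤⟨ +-monoˡ-≤ x (length-Between x n uB (All.tabulate λ y∈B → ≪-lookup A≪B x∈A y∈B , All.lookup B≤n y∈B)) ⟩
    n ∸ x + x             ≡⟨ m∸n+n≡m (All.lookup A≤n x∈A) ⟩
    n                     ≡⟨ trans (sym len) (+-comm (length A) (length B)) ⟩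
    length B + length A   ∎)
    where open ≤-Reasoning

upper-block : ∀ {A B} → Unique A → All (1 ≤_) A → All (1 ≤_) B → A ≪ B → All (length A <_) B
upper-block {A} {B} uA 1≤A 1≤B A≪B = All.tabulate bound
  where
  bound : ∀ {y} → y ∈ B → length A < y
  bound {y} y∈B = subst (length A <_) (m+[n∸m]≡n (All.lookup 1≤B y∈B))
    (s≤s (length-Between 0 (y ∸ 1) uA (All.tabulate λ x∈A → All.lookup 1≤A x∈A , ∸-monoˡ-≤ 1 (≪-lookup A≪B x∈A y∈B))))

unshift : ∀ k {xs} → All (k <_) xs → shift k (map (_∸ k) xs) ≡ xs
unshift k [] = refl
unshift k (k<x ∷ ps) = cong₂ _∷_ (m+[n∸m]≡n (<⇒≤ k<x)) (unshift k ps)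

Standardized : ℕ → List ℕ → Set
Standardized k xs = IsPerm (length xs) (map (_∸ k) xs) × shift k (map (_∸ k) xs) ≡ xs

blocks-IsPerm : ∀ n {L H} → Unique L → Unique H → All (InRange n) L → All (InRange n) H →
                length L + length H ≡ n → L ≪ H → IsPerm (length L) L × Standardized (length L) H
blocks-IsPerm n {L} {H} uL uH rL rH len L≪H =
  record { length-≡ = refl ; unique = uL ; inRange = All.zip (All.map proj₁ rL , L≤) } ,
  record { length-≡ = length-map (_∸ length L) H ; unique = Unique.map⁻ (subst Unique (sym (unshift _ L<H)) uH)
         ; inRange = All.map⁺ (All.zipWith standard (L<H , rH)) } ,
  unshift _ L<H
  where
  L≤ = lower-block n uH (All.map proj₂ rL) (All.map proj₂ rH) len L≪H
  L<H = upper-block uL (All.map proj₁ rL) (All.map proj₁ rH) L≪H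
  standard : ∀ {x} → length L < x × InRange n x → InRange (length H) (x ∸ length L)
  standard {x} (L<x , _ , x≤n) =
    subst (_≤ x ∸ length L) (m+n∸m≡n (length L) 1) (∸-monoˡ-≤ (length L) (subst (_≤ x) (+-comm 1 (length L)) L<x)) ,
    subst (x ∸ length L ≤_) (trans (cong (_∸ length L) (sym len)) (m+n∸m≡n (length L) (length H))) (∸-monoˡ-≤ (length L) x≤n)

-- Surjectivity of treePerm

graft : Label → BTree → BTree → BTree
graft ⊕ L (node ⊕ R₁ R₂) = node ⊕ (graft ⊕ L R₁) R₂
graft ⊖ L (node ⊖ R₁ R₂) = node ⊖ (graft ⊖ L R₁) R₂
graft s L R = node s L R

size-graft : ∀ s L R → size (graft s L R) ≡ size (node s L R)
size-graft ⊕ L (node ⊕ R₁ R₂) =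
  cong suc (trans (cong (_+ size R₂) (size-graft ⊕ L R₁)) (sym (+-suc-+ (size L) (size R₁) (size R₂))))
size-graft ⊖ L (node ⊖ R₁ R₂) =
  cong suc (trans (cong (_+ size R₂) (size-graft ⊖ L R₁)) (sym (+-suc-+ (size L) (size R₁) (size R₂))))
size-graft ⊕ L leaf = refl
size-graft ⊕ L (node ⊖ _ _) = refl
size-graft ⊖ L leaf = refl
size-graft ⊖ L (node ⊕ _ _) = refl

shift-shift : ∀ a b xs → shift a (shift b xs) ≡ shift (a + b) xs
shift-shift a b [] = refl
shift-shift a b (x ∷ xs) = cong₂ _∷_ (sym (+-assoc a b x)) (shift-shift a b xs)

treePerm-graft : ∀ s L R → treePerm (graft s L R) ≡ treePerm (node s L R)
treePerm-graft ⊕ L (node ⊕ R₁ R₂)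
  rewrite size-graft ⊕ L R₁ | treePerm-graft ⊕ L R₁
        | map-++ (suc (size L) +_) (treePerm R₁) (shift (suc (size R₁)) (treePerm R₂))
        | shift-shift (suc (size L)) (suc (size R₁)) (treePerm R₂) | size-node⊕ ⊕ L R₁ =
  ++-assoc (treePerm L) (shift (suc (size L)) (treePerm R₁)) _
treePerm-graft ⊖ L (node ⊖ R₁ R₂)
  rewrite treePerm-graft ⊖ L R₁
        | map-++ (suc (size R₂) +_) (shift (suc (size R₁)) (treePerm L)) (treePerm R₁)
        | shift-shift (suc (size R₂)) (suc (size R₁)) (treePerm L) | size-node⊖ ⊖ R₁ R₂ =
  ++-assoc (shift _ (treePerm L)) (shift (suc (size R₂)) (treePerm R₁)) (treePerm R₂)
treePerm-graft ⊕ L leaf = refl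
treePerm-graft ⊕ L (node ⊖ _ _) = refl
treePerm-graft ⊖ L leaf = refl
treePerm-graft ⊖ L (node ⊕ _ _) = refl

isDiSk-graft : ∀ s L R → isDiSk L ≡ true → isDiSk R ≡ true → isDiSk (graft s L R) ≡ true
isDiSk-graft ⊕ L (node ⊕ R₁ R₂) dL dR =
  node-diSk ⊕ (graft ⊕ L R₁) R₂ (rootOK ⊕ R₁ R₂ dR) (isDiSk-graft ⊕ L R₁ dL (leftDiSk ⊕ R₁ R₂ dR)) (rightDiSk ⊕ R₁ R₂ dR)
isDiSk-graft ⊖ L (node ⊖ R₁ R₂) dL dR =
  node-diSk ⊖ (graft ⊖ L R₁) R₂ (rootOK ⊖ R₁ R₂ dR) (isDiSk-graft ⊖ L R₁ dL (leftDiSk ⊖ R₁ R₂ dR)) (rightDiSk ⊖ R₁ R₂ dR)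
isDiSk-graft ⊕ L leaf dL dR = node-diSk ⊕ L leaf refl dL dR
isDiSk-graft ⊕ L (node ⊖ a b) dL dR = node-diSk ⊕ L (node ⊖ a b) refl dL dR
isDiSk-graft ⊖ L leaf dL dR = node-diSk ⊖ L leaf refl dL dR
isDiSk-graft ⊖ L (node ⊕ a b) dL dR = node-diSk ⊖ L (node ⊕ a b) refl dL dR

TreePreimage : ℕ → List ℕ → Set
TreePreimage n π = Σ[ T ∈ BTree ] isDiSk T ≡ true × suc (size T) ≡ n × treePerm T ≡ π

graft-⊕-preimage : ∀ {A B₀ B} → TreePreimage (length A) A → TreePreimage (length B) B₀ →
                   shift (length A) B₀ ≡ B → TreePreimage (length A + length B) (A ++ B)
graft-⊕-preimage (Tₗ , dₗ , sₗ , pₗ) (Tᵣ , dᵣ , sᵣ , pᵣ) e =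
  graft ⊕ Tₗ Tᵣ , isDiSk-graft ⊕ Tₗ Tᵣ dₗ dᵣ ,
  trans (cong suc (size-graft ⊕ Tₗ Tᵣ)) (trans (sym (size-node⊕ ⊕ Tₗ Tᵣ)) (cong₂ _+_ sₗ sᵣ)) ,
  trans (treePerm-graft ⊕ Tₗ Tᵣ) (cong₂ _++_ pₗ (trans (cong₂ shift sₗ pᵣ) e))

graft-⊖-preimage : ∀ {A₀ A B} → TreePreimage (length A) A₀ → shift (length B) A₀ ≡ A →
                   TreePreimage (length B) B → TreePreimage (length A + length B) (A ++ B)
graft-⊖-preimage {A = A} {B} (Tₗ , dₗ , sₗ , pₗ) e (Tᵣ , dᵣ , sᵣ , pᵣ) =
  graft ⊖ Tₗ Tᵣ , isDiSk-graft ⊖ Tₗ Tᵣ dₗ dᵣ ,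
  trans (cong suc (size-graft ⊖ Tₗ Tᵣ)) (trans (sym (size-node⊖ ⊖ Tₗ Tᵣ)) (trans (cong₂ _+_ sᵣ sₗ) (+-comm (length B) (length A)))) ,
  trans (treePerm-graft ⊖ Tₗ Tᵣ) (cong₂ _++_ (trans (cong₂ shift sᵣ pₗ) e) pᵣ)

NonEmpty⇒1≤length : ∀ {xs} → NonEmpty xs → 1 ≤ length xs
NonEmpty⇒1≤length (nonEmpty _ _) = s≤s z≤n

IsPerm-++⁻ : ∀ n A {B} → IsPerm n (A ++ B) →
  (Unique A × Unique B) × (All (InRange n) A × All (InRange n) B) × length A + length B ≡ n
IsPerm-++⁻ n A p = Unique-++⁻ A unique , All.++⁻ A inRange , trans (sym (length-++ A)) length-≡
  where open IsPerm p

PreimagesBelow : ℕ → Set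
PreimagesBelow n = ∀ {m} → m < n → ∀ π → 1 ≤ m → IsPerm m π → ¬ ContainsForbidden π → TreePreimage m π

direct-preimage : ∀ {n A B} → PreimagesBelow n → NonEmpty A → NonEmpty B → A ≪ B →
                  IsPerm n (A ++ B) → ¬ ContainsForbidden (A ++ B) → TreePreimage n (A ++ B)
direct-preimage {n} {A} {B} rec neA neB A≪B p ¬cf =
  let (uA , uB) , (rA , rB) , len = IsPerm-++⁻ n A p
      pA , pB₀ , eB = blocks-IsPerm n uA uB rA rB len A≪B
      A<n = subst (length A <_) len (m<m+n (length A) (NonEmpty⇒1≤length neB))
      B<n = subst (length B <_) len (m<n+m (length B) (NonEmpty⇒1≤length neA))
  in subst (λ m → TreePreimage m (A ++ B)) len (graft-⊕-preimage
       (rec A<n A (NonEmpty⇒1≤length neA) pA (¬cf ∘ ContainsForbidden-⊆ (++⁺ʳ B ⊆-refl)))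
       (rec B<n _ (NonEmpty⇒1≤length neB) pB₀
            (¬cf ∘ ContainsForbidden-⊆ (++⁺ˡ A ⊆-refl) ∘ subst ContainsForbidden eB ∘ ContainsForbidden-shift⁺ _ _))
       eB)

skew-preimage : ∀ {n A B} → PreimagesBelow n → NonEmpty A → NonEmpty B → B ≪ A →
                IsPerm n (A ++ B) → ¬ ContainsForbidden (A ++ B) → TreePreimage n (A ++ B)
skew-preimage {n} {A} {B} rec neA neB B≪A p ¬cf =
  let (uA , uB) , (rA , rB) , len = IsPerm-++⁻ n A p
      pB , pA₀ , eA = blocks-IsPerm n uB uA rB rA (trans (+-comm (length B) (length A)) len) B≪A
      A<n = subst (length A <_) len (m<m+n (length A) (NonEmpty⇒1≤length neB))
      B<n = subst (length B <_) len (m<n+m (length B) (NonEmpty⇒1≤length neA))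
  in subst (λ m → TreePreimage m (A ++ B)) len (graft-⊖-preimage
       (rec A<n _ (NonEmpty⇒1≤length neA) pA₀
            (¬cf ∘ ContainsForbidden-⊆ (++⁺ʳ B ⊆-refl) ∘ subst ContainsForbidden eA ∘ ContainsForbidden-shift⁺ _ _))
       eA
       (rec B<n B (NonEmpty⇒1≤length neB) pB (¬cf ∘ ContainsForbidden-⊆ (++⁺ˡ A ⊆-refl))))

treePerm-onto : ∀ n π → 1 ≤ n → IsPerm n π → ¬ ContainsForbidden π → TreePreimage n π
treePerm-onto = <-rec _ onto
  where
  onto : ∀ n → PreimagesBelow n → ∀ π → 1 ≤ n → IsPerm n π → ¬ ContainsForbidden π → TreePreimage n π
  onto n rec [] 1≤n p _ with IsPerm.length-≡ p | 1≤n
  ... | refl | ()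
  onto n rec (x ∷ []) _ p _ with IsPerm.length-≡ p | IsPerm.inRange p
  ... | refl | (1≤x , x≤1) ∷ [] with ≤-antisym x≤1 1≤x
  ...   | refl = leaf , refl , refl , refl
  onto n rec π@(_ ∷ _ ∷ _) _ p ¬cf with separable-split π (IsPerm.unique p) ¬cf (s≤s (s≤s z≤n))
  ... | inj₁ (A , B , neA , neB , e , A≪B) =
    subst (TreePreimage n) (sym e) (direct-preimage rec neA neB A≪B (subst (IsPerm n) e p) (¬cf ∘ subst ContainsForbidden (sym e)))
  ... | inj₂ (A , B , neA , neB , e , B≪A) =
    subst (TreePreimage n) (sym e) (skew-preimage rec neA neB B≪A (subst (IsPerm n) e p) (¬cf ∘ subst ContainsForbidden (sym e)))

SepPerm-preimage : ∀ {n a b} → 1 ≤ n → (y : SepPerm n a b) → TreePreimage n (proj₁ y)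
SepPerm-preimage {n} 1≤n (π , p , av , _) =
  treePerm-onto n π 1≤n (isPerm⇒IsPerm n π p) (avoids⇒¬ContainsForbidden π av)

DT↔SepPerm : ∀ n k l → 1 ≤ n → DT n k l ↔ SepPerm n (suc k) (suc l)
DT↔SepPerm n k l 1≤n = mk↔ₛ′ to from
  (λ y → SepPerm-≡ (proj₂ (proj₂ (proj₂ (SepPerm-preimage 1≤n y)))))
  (λ x@(T , d , _) → let T′ , d′ , _ , e = SepPerm-preimage 1≤n (to x) in
                     DT-≡ (treePerm-injective T′ T d′ d e))
  where
  to : DT n k l → SepPerm n (suc k) (suc l)
  to (T , d , s , t , i) =
    treePerm T , IsPerm⇒isPerm n (treePerm T) (subst (λ m → IsPerm m (treePerm T)) s (treePerm-IsPerm T)) ,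
    ¬ContainsForbidden⇒avoids (treePerm T) (treePerm-avoids T) ,
    trans (comp-treePerm T d) (cong suc t) , trans (idr-treePerm T) (cong suc i)

  from : SepPerm n (suc k) (suc l) → DT n k l
  from y@(π , _ , _ , c , i) =
    let T , d , s , e = SepPerm-preimage 1≤n y in
    T , d , s ,
    suc-injective (trans (sym (comp-treePerm T d)) (trans (cong comp e) c)) ,
    suc-injective (trans (sym (idr-treePerm T)) (trans (cong idr e) i))

SepPerm-comp≥1 : ∀ {n b} → 1 ≤ n → SepPerm n 0 b → ⊥
SepPerm-comp≥1 1≤n y@(_ , _ , _ , c , _) with SepPerm-preimage 1≤n y
... | T , d , _ , refl with trans (sym c) (comp-treePerm T d)
... | ()

SepPerm-idr≥1 : ∀ {n a} → 1 ≤ n → SepPerm n a 0 → ⊥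
SepPerm-idr≥1 1≤n y@(_ , _ , _ , _ , i) with SepPerm-preimage 1≤n y
... | T , _ , _ , refl with trans (sym i) (idr-treePerm T)
... | ()

ψ-iterate : ∀ n j k l → DT n (j + k) l ↔ DT n k (j + l)
ψ-iterate n zero k l = ↔-refl
ψ-iterate n (suc j) k l =
  ↔-trans (ψ-DT n (suc j + k) l (s≤s z≤n))
          (subst (λ m → DT n (j + k) (l + 1) ↔ DT n k m) (trans (cong (j +_) (+-comm l 1)) (+-suc j l))
                 (ψ-iterate n j k (l + 1)))

DT-swap : ∀ n k l → DT n k l ↔ DT n l k
DT-swap n k l with ≤-total l k
... | inj₁ l≤k = subst (λ m → DT n m l ↔ DT n l m) (m∸n+n≡m l≤k) (ψ-iterate n (k ∸ l) l l)
... | inj₂ k≤l = ↔-sym (subst (λ m → DT n m k ↔ DT n k m) (m∸n+n≡m k≤l) (ψ-iterate n (l ∸ k) k k))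

↔-empty : ∀ {A B : Set} → (A → ⊥) → (B → ⊥) → A ↔ B
↔-empty ¬a ¬b = mk↔ₛ′ (⊥-elim ∘ ¬a) (⊥-elim ∘ ¬b) (⊥-elim ∘ ¬b) (⊥-elim ∘ ¬a)

SepPerm-swap : ∀ n → 1 ≤ n → ∀ a b → SepPerm n a b ↔ SepPerm n b a
SepPerm-swap n 1≤n zero b = ↔-empty (SepPerm-comp≥1 1≤n) (SepPerm-idr≥1 1≤n)
SepPerm-swap n 1≤n (suc a) zero = ↔-empty (SepPerm-idr≥1 1≤n) (SepPerm-comp≥1 1≤n)
SepPerm-swap n 1≤n (suc a) (suc b) =
  ↔-trans (↔-sym (DT↔SepPerm n a b 1≤n)) (↔-trans (DT-swap n a b) (DT↔SepPerm n b a 1≤n))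

theorem4p4 : (n : ℕ) → 1 ≤ n →
    ((k l : ℕ) → 1 ≤ k → DT n k l ⤖ DT n (k ∸ 1) (l + 1))
    × ((a b : ℕ) → SepPerm n a b ⤖ SepPerm n b a)
theorem4p4 n 1≤n = (λ k l 1≤k → ↔⇒⤖ (ψ-DT n k l 1≤k)) , (λ a b → ↔⇒⤖ (SepPerm-swap n 1≤n a b))
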